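{- Let $f,g\in\mathcal O_K$. 1. If $f,g\in\mathcal O_K^0$, then $|f+g|_\theta\le\theta\max\{|f|_\theta,|g|_\theta\}$. 2. If $f,g\in\mathcal O_K^1$, then $|f+g|_\theta\le\theta^2\max\{|f|_\theta,|g|_\theta\}$. 3. If $f\in\mathcal O_K^0$ and $g\in\mathcal O_K^1$, then $|f+g|_\theta\le\theta^4\max\{|f|_\theta,|g|_\theta\}$. In particular, $|\cdot|_\theta$ is an infranorm on $\mathcal O_K$ with $\rho=\theta^4$.
   Context: $\theta>1$ is a real quadratic unit with $N(\theta)=1$, so $\theta^2=a\theta-1$ with an integer $a\ge3$ and $\theta'=\theta^{ -1}$; $K=\mathbb Q(\theta)\subset\mathbb R$, $\mathcal O_K$ its ring of integers, $\alpha'$ the Galois conjugate. A greedy polynomial is a finite sum $\sum_{i=m}^M b_i\theta^i$ with $b_i\in\{0,\dots,a-1\}$ containing no digit subword $b_ib_{i-1}\cdots b_{i-k}$ ($k\ge1$) of the form $(a-1)(a-2)\cdots(a-2)(a-1)$ (including $(a-1)(a-1)$). Let $\mathcal O_K^0=\{\alpha\in\mathcal O_K:\operatorname{sgn}\alpha=\operatorname{sgn}\alpha'\}\cup\{0\}$, $\mathcal O_K^1=\{\alpha\in\mathcal O_K:\operatorname{sgn}\alpha\ne\operatorname{sgn}\alpha'\}\cup\{0\}$. Each nonzero $\alpha\in\mathcal O_K^0$ is uniquely $\pm$ a greedy polynomial $\sum_{i=m}^Mb_i\theta^i$ with $b_m\ne0$; set $|\alpha|_\theta=\theta^{ -m}$,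 $|0|_\theta=0$. With $T=\theta-1$, for $\alpha\in\mathcal O_K^1$ one has $T\alpha\in\mathcal O_K^0$ and $|\alpha|_\theta:=|T\alpha|_\theta$. An infranorm with constant $\rho\ge1$ on an abelian group $G$ is a function $|\cdot|:G\to\mathbb R_{\ge0}$ with $|x|=0\iff x=0$, $|-x|=|x|$, and $|x\pm y|\le\rho\max\{|x|,|y|\}$ for all $x,y$. -}

module Defs where

open import Data.Nat as ℕ using (ℕ; zero; suc)
open import Data.Integer as ℤ using (ℤ; +_; -[1+_])
open import Data.Bool using (Bool; true; false; T; if_then_else_; _∧_; _∨_; not)
open import Data.List using (List; []; _∷_; _++_; replicate)
open import Data.List.Relation.Unary.All using (All)
open import Data.Product using (Σ; ∃; _×_; _,_)
open import Data.Sum using (_⊎_)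
open import Relation.Binary.PropositionalEquality using (_≡_; _≢_)
open import Relation.Nullary using (¬_)

-- An element  re + im·θ  of ℤ[θ] (= ℤ[θ,θ⁻¹], since θ is a unit).
record Zθ : Set where
  constructor ⟨_,_⟩
  field
    re : ℤ
    im : ℤ

open Zθ public

infix 4 _<ᶻ_ _=ᶻ_

_<ᶻ_ : ℤ → ℤ → Bool
i <ᶻ j = not (j ℤ.≤ᵇ i)

_=ᶻ_ : ℤ → ℤ → Bool
i =ᶻ j = (i ℤ.≤ᵇ j) ∧ (j ℤ.≤ᵇ i)

-- Everything below depends on the integer a (θ² = aθ - 1, a ≥ 3 assumed in the theorem).
module Q (a : ℕ) where

  A : ℤ
  A = + a

  -- discriminant a² - 4 ; θ = (a + √D)/2 > 1
  D : ℤ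
  D = A ℤ.* A ℤ.- (+ 4)

  𝟘 𝟙 θ θ⁻¹ : Zθ
  𝟘 = ⟨ + 0 , + 0 ⟩
  𝟙 = ⟨ + 1 , + 0 ⟩
  θ = ⟨ + 0 , + 1 ⟩
  θ⁻¹ = ⟨ A , ℤ.- + 1 ⟩

  fromℕ : ℕ → Zθ
  fromℕ b = ⟨ + b , + 0 ⟩

  infixl 6 _+_ _-_
  infixl 7 _*_
  infix 8 -_

  _+_ : Zθ → Zθ → Zθ
  ⟨ x , y ⟩ + ⟨ u , v ⟩ = ⟨ x ℤ.+ u , y ℤ.+ v ⟩

  -_ : Zθ → Zθ
  - ⟨ x , y ⟩ = ⟨ ℤ.- x , ℤ.- y ⟩

  _-_ : Zθ → Zθ → Zθ
  α - β = α + (- β)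

  -- (x + yθ)(u + vθ) = xu - yv + (xv + yu + a·yv)θ, using θ² = aθ - 1
  _*_ : Zθ → Zθ → Zθ
  ⟨ x , y ⟩ * ⟨ u , v ⟩ = ⟨ x ℤ.* u ℤ.- y ℤ.* v , x ℤ.* v ℤ.+ y ℤ.* u ℤ.+ A ℤ.* y ℤ.* v ⟩

  -- Galois conjugate: θ' = θ⁻¹ = a - θ
  conj : Zθ → Zθ
  conj ⟨ x , y ⟩ = ⟨ x ℤ.+ A ℤ.* y , ℤ.- y ⟩

  powℕ : Zθ → ℕ → Zθ
  powℕ β zero = 𝟙
  powℕ β (suc n) = β * powℕ β n

  pow : ℤ → Zθ
  pow (+ n) = powℕ θ n
  pow -[1+ n ] = powℕ θ⁻¹ (suc n)

  -- x + yθ > 0 as a real number.  With u = 2x + a y we have 2(x + yθ) = u + y√D.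
  isPos : Zθ → Bool
  isPos ⟨ x , y ⟩ =
    if (+ 0) <ᶻ y then ((+ 0) ℤ.≤ᵇ u) ∨ ((u ℤ.* u) <ᶻ (y ℤ.* y ℤ.* D))
    else if y <ᶻ (+ 0) then ((+ 0) <ᶻ u) ∧ ((y ℤ.* y ℤ.* D) <ᶻ (u ℤ.* u))
    else (+ 0) <ᶻ u
    where
    u : ℤ
    u = (+ 2) ℤ.* x ℤ.+ A ℤ.* y

  isZero : Zθ → Bool
  isZero ⟨ x , y ⟩ = (x =ᶻ (+ 0)) ∧ (y =ᶻ (+ 0))

  Pos Neg : Zθ → Set
  Pos α = T (isPos α)
  Neg α = Pos (- α)

  _≤ᵇ_ : Zθ → Zθ → Bool
  α ≤ᵇ β = isZero (β - α) ∨ isPos (β - α)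

  infix 4 _≤_
  _≤_ : Zθ → Zθ → Set
  α ≤ β = T (α ≤ᵇ β)

  max : Zθ → Zθ → Zθ
  max α β = if α ≤ᵇ β then β else α

  InO0 : Zθ → Set
  InO0 α = (α ≡ 𝟘) ⊎ (Pos α × Pos (conj α)) ⊎ (Neg α × Neg (conj α))

  InO1 : Zθ → Set
  InO1 α = (α ≡ 𝟘) ⊎ (Pos α × Neg (conj α)) ⊎ (Neg α × Pos (conj α))

  Tθ : Zθ
  Tθ = θ - 𝟙

  -- Digit lists are read from the LOWEST exponent upwards: b_m ∷ b_{m+1} ∷ … ∷ b_M.
  horner : List ℕ → Zθ
  horner [] = 𝟘
  horner (b ∷ bs) = fromℕ b + θ * horner bs

  eval : ℤ → List ℕ → Zθ
  eval m ds = pow m * horner ds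

  -- the forbidden word (a-1)(a-2)^j(a-1), j ≥ 0 (a palindrome, so the reading
  -- direction does not matter)
  pattern' : ℕ → List ℕ
  pattern' j = (a ℕ.∸ 1) ∷ (replicate j (a ℕ.∸ 2) ++ ((a ℕ.∸ 1) ∷ []))

  NoForbidden : List ℕ → Set
  NoForbidden ds = ¬ (Σ (List ℕ) λ pre → Σ (List ℕ) λ suf → Σ ℕ λ j →
                        ds ≡ pre ++ (pattern' j ++ suf))

  IsGreedy : List ℕ → Set
  IsGreedy ds = All (λ b → b ℕ.< a) ds × NoForbidden ds

  GreedyLowExp : Zθ → ℤ → Set
  GreedyLowExp α m = Σ ℕ λ b → Σ (List ℕ) λ bs →
    (b ≢ 0) × IsGreedy (b ∷ bs) × ((α ≡ eval m (b ∷ bs)) ⊎ (α ≡ - eval m (b ∷ bs)))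

  IsThetaNorm : (Zθ → Zθ) → Set
  IsThetaNorm N = ∀ α →
    ((α ≡ 𝟘) → N α ≡ 𝟘)
    × (InO0 α → α ≢ 𝟘 → Σ ℤ λ m → GreedyLowExp α m × (N α ≡ pow (ℤ.- m)))
    × (InO1 α → α ≢ 𝟘 → N α ≡ N (Tθ * α))

  IsInfranorm : (Zθ → Zθ) → Zθ → Set
  IsInfranorm N ρ =
    (𝟙 ≤ ρ)
    × (∀ x → 𝟘 ≤ N x)
    × (∀ x → (N x ≡ 𝟘 → x ≡ 𝟘) × (x ≡ 𝟘 → N x ≡ 𝟘))
    × (∀ x → N (- x) ≡ N x)
    × (∀ x y → (N (x + y) ≤ ρ * max (N x) (N y)) × (N (x - y) ≤ ρ * max (N x) (N y)))

-- Put D = a² - 4, so that θ = (a + √D)/2 and conjugation is √D ↦ -√D. For a nonzero α ∈ 𝒪⁰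
-- with greedy expansion ±Σ_{i≥m} bᵢθⁱ we get α' = ±θ⁻ᵐ Σⱼ b_{m+j}θ⁻ʲ, and the greedy condition
-- keeps the last sum in [1, θ): so |α|_θ = θ⁻ᵐ is the power of θ with |α|_θ ≤ |α'| < θ|α|_θ.
-- For α ∈ 𝒪¹ this applies to Tα, whose conjugate is -(θ - 1)θ⁻¹α'. From |f' + g'| ≤ |f'| + |g'|
-- one gets |f + g|_θ ≤ 2θM, resp. (θ - 1)|f + g|_θ ≤ 2θ²M, for M = max(|f|_θ, |g|_θ); since θ > 2
-- and (θ - 1)θ > 2, the discreteness of the powers of θ improves these to |f + g|_θ ≤ θM, resp. θ²M.
-- The order of K is decided on p + q√D by comparing p² with q²D, √D being irrational as
-- (a - 1)² < D < a².

module Submission where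

open import Defs
open import Algebra.Bundles using (CommutativeRing)
open import Algebra.Core using (Op₁; Op₂)
open import Algebra.Structures using (IsCommutativeRing)
import Algebra.Properties.Ring as RingProperties
open import Data.Bool using (Bool; true; false; T; not; if_then_else_; _∧_; _∨_)
open import Data.Bool.Properties using (T-∧; T-∨)
open import Data.Empty using (⊥-elim)
open import Data.Integer as ℤ using (ℤ; +_; +[1+_]; -[1+_]; 0ℤ; 1ℤ)
import Data.Integer.Properties as ℤP
open import Data.Integer.Tactic.RingSolver using (solve-∀)
open import Data.List using (List; []; _∷_; _++_; replicate)
import Data.List.Properties as List
open import Data.List.Relation.Unary.All using (All; _∷_)
import Data.Nat as ℕ
open import Data.Nat using (ℕ; zero; suc; z≤n; s≤s)
open import Data.Nat.Induction using (<-wellFounded)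
import Data.Nat.Properties as ℕP
open import Data.Product using (Σ; ∃; _×_; _,_; proj₁; proj₂)
open import Data.Sum using (_⊎_; inj₁; inj₂; swap)
open import Data.Unit using (tt)
open import Function using (_∘_)
open import Function.Bundles using (Equivalence)
open import Induction.WellFounded using (Acc; acc)
open import Level using (0ℓ)
open import Relation.Binary.Bundles using (StrictPartialOrder)
open import Relation.Binary.Core using (Rel)
open import Relation.Binary.Definitions using (RightMonotonic; Trichotomous; Tri; tri<; tri≈; tri>)
open import Relation.Binary.PropositionalEquality
import Relation.Binary.Reasoning.StrictPartialOrder as StrictReasoning
open import Relation.Binary.Structures using (IsStrictTotalOrder)
open import Relation.Nullary using (¬_; yes; no)
open import Relation.Nullary.Reflects using (Reflects; ofʸ; ofⁿ; fromEquivalence)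

record OrderedCommutativeRing : Set₁ where
  infix  4 _<_
  infixl 6 _+_
  infixl 7 _*_
  infix  8 -_
  field
    Carrier              : Set
    _+_ _*_              : Op₂ Carrier
    -_                   : Op₁ Carrier
    0# 1#                : Carrier
    isCommutativeRing    : IsCommutativeRing _≡_ _+_ _*_ -_ 0# 1#
    _<_                  : Rel Carrier 0ℓ
    <-isStrictTotalOrder : IsStrictTotalOrder _≡_ _<_
    +-monoˡ-<            : RightMonotonic _<_ _<_ _+_
    0<1                  : 0# < 1#
    0<*                  : ∀ {x y} → 0# < x → 0# < y → 0# < x * y

module OrderedCommutativeRingProperties (R : OrderedCommutativeRing) where

  open OrderedCommutativeRing R public
  open IsCommutativeRing isCommutativeRing public
    using (+-assoc; +-comm; +-identityˡ; +-identityʳ; -‿inverseˡ; -‿inverseʳ;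
           *-assoc; *-comm; *-identityˡ; *-identityʳ; distribˡ; distribʳ; zeroˡ; zeroʳ)
  open IsStrictTotalOrder <-isStrictTotalOrder public
    using (compare) renaming (trans to <-trans; irrefl to <-irrefl; asym to <-asym)

  commutativeRing : CommutativeRing 0ℓ 0ℓ
  commutativeRing = record { isCommutativeRing = isCommutativeRing }

  open CommutativeRing commutativeRing public using (_-_)
  open RingProperties (CommutativeRing.ring commutativeRing) public
    using (-‿involutive; -‿injective; -‿distribˡ-*; -‿distribʳ-*; -0#≈0#; -‿+-comm; x∙y⁻¹≈ε⇒x≈y)

  strictPartialOrder : StrictPartialOrder 0ℓ 0ℓ 0ℓ
  strictPartialOrder = record
    { isStrictPartialOrder = IsStrictTotalOrder.isStrictPartialOrder <-isStrictTotalOrder }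

  module ≤-Reasoning = StrictReasoning strictPartialOrder

  infix 4 _≤_
  _≤_ : Rel Carrier 0ℓ
  x ≤ y = x < y ⊎ x ≡ y

  <⇒≤ : ∀ {x y} → x < y → x ≤ y
  <⇒≤ = inj₁

  ≤-refl : ∀ {x} → x ≤ x
  ≤-refl = inj₂ refl

  <-≤-trans : ∀ {x y z} → x < y → y ≤ z → x < z
  <-≤-trans x<y (inj₁ y<z) = <-trans x<y y<z
  <-≤-trans x<y (inj₂ refl) = x<y

  ≤-<-trans : ∀ {x y z} → x ≤ y → y < z → x < z
  ≤-<-trans (inj₁ x<y) y<z = <-trans x<y y<z
  ≤-<-trans (inj₂ refl) y<z = y<z

  ≤-trans : ∀ {x y z} → x ≤ y → y ≤ z → x ≤ z
  ≤-trans (inj₁ x<y) y≤z = inj₁ (<-≤-trans x<y y≤z)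
  ≤-trans (inj₂ refl) y≤z = y≤z

  ≤⇒≯ : ∀ {x y} → x ≤ y → ¬ (y < x)
  ≤⇒≯ x≤y y<x = <-irrefl refl (≤-<-trans x≤y y<x)

  ≤-antisym : ∀ {x y} → x ≤ y → y ≤ x → x ≡ y
  ≤-antisym (inj₂ x≡y) _ = x≡y
  ≤-antisym (inj₁ x<y) y≤x = ⊥-elim (≤⇒≯ y≤x x<y)

  ≮⇒≥ : ∀ {x y} → ¬ (x < y) → y ≤ x
  ≮⇒≥ {x} {y} x≮y with compare x y
  ... | tri< x<y _ _ = ⊥-elim (x≮y x<y)
  ... | tri≈ _ x≡y _ = inj₂ (sym x≡y)
  ... | tri> _ _ y<x = inj₁ y<x

  ≰⇒> : ∀ {x y} → ¬ (x ≤ y) → y < x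
  ≰⇒> {x} {y} x≰y with compare x y
  ... | tri< x<y _ _ = ⊥-elim (x≰y (inj₁ x<y))
  ... | tri≈ _ x≡y _ = ⊥-elim (x≰y (inj₂ x≡y))
  ... | tri> _ _ y<x = y<x

  +-monoʳ-< : ∀ z {x y} → x < y → z + x < z + y
  +-monoʳ-< z {x} {y} x<y = subst₂ _<_ (+-comm x z) (+-comm y z) (+-monoˡ-< z x<y)

  +-monoˡ-≤ : ∀ z {x y} → x ≤ y → x + z ≤ y + z
  +-monoˡ-≤ z (inj₁ x<y) = inj₁ (+-monoˡ-< z x<y)
  +-monoˡ-≤ z (inj₂ refl) = ≤-refl

  +-monoʳ-≤ : ∀ z {x y} → x ≤ y → z + x ≤ z + y
  +-monoʳ-≤ z (inj₁ x<y) = inj₁ (+-monoʳ-< z x<y)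
  +-monoʳ-≤ z (inj₂ refl) = ≤-refl

  +-mono-≤ : ∀ {x y u v} → x ≤ y → u ≤ v → x + u ≤ y + v
  +-mono-≤ {y = y} {u} x≤y u≤v = ≤-trans (+-monoˡ-≤ u x≤y) (+-monoʳ-≤ y u≤v)

  +-mono-<-≤ : ∀ {x y u v} → x < y → u ≤ v → x + u < y + v
  +-mono-<-≤ {y = y} {u} x<y u≤v = <-≤-trans (+-monoˡ-< u x<y) (+-monoʳ-≤ y u≤v)

  x-y+y≡x : ∀ x y → x - y + y ≡ x
  x-y+y≡x x y = trans (+-assoc x (- y) y) (trans (cong (_+_ x) (-‿inverseˡ y)) (+-identityʳ x))

  0<y-x⇒x<y : ∀ {x y} → 0# < y - x → x < y
  0<y-x⇒x<y {x} {y} p = subst₂ _<_ (+-identityˡ x) (x-y+y≡x y x) (+-monoˡ-< x p)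

  x<y⇒0<y-x : ∀ {x y} → x < y → 0# < y - x
  x<y⇒0<y-x {x} {y} x<y = subst₂ _<_ (-‿inverseʳ x) refl (+-monoˡ-< (- x) x<y)

  +-cancelʳ-< : ∀ z {x y} → x + z < y + z → x < y
  +-cancelʳ-< z {x} {y} x+z<y+z = subst₂ _<_ (x+z-z≡x x) (x+z-z≡x y) (+-monoˡ-< (- z) x+z<y+z)
    where
    x+z-z≡x : ∀ x → x + z - z ≡ x
    x+z-z≡x x = trans (+-assoc x z (- z)) (trans (cong (_+_ x) (-‿inverseʳ z)) (+-identityʳ x))

  x-y<x : ∀ {x y} → 0# < y → x - y < x
  x-y<x {x} {y} 0<y = subst₂ _<_ (+-identityʳ (x - y)) (x-y+y≡x x y) (+-monoʳ-< (x - y) 0<y)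

  x<y⇒x-y<0 : ∀ {x y} → x < y → x - y < 0#
  x<y⇒x-y<0 {x} {y} x<y = subst₂ _<_ refl (-‿inverseʳ y) (+-monoˡ-< (- y) x<y)

  x-y<0⇒x<y : ∀ {x y} → x - y < 0# → x < y
  x-y<0⇒x<y {x} {y} p = subst₂ _<_ (x-y+y≡x x y) (+-identityˡ y) (+-monoˡ-< y p)

  x≤y⇒0≤y-x : ∀ {x y} → x ≤ y → 0# ≤ y - x
  x≤y⇒0≤y-x (inj₁ x<y) = inj₁ (x<y⇒0<y-x x<y)
  x≤y⇒0≤y-x {x} (inj₂ refl) = inj₂ (sym (-‿inverseʳ x))

  -x<y⇒0<y+x : ∀ {x y} → - x < y → 0# < y + x
  -x<y⇒0<y+x {x} {y} -x<y = subst (0# <_) (cong (_+_ y) (-‿involutive x)) (x<y⇒0<y-x -x<y)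

  neg-mono-< : ∀ {x y} → x < y → - y < - x
  neg-mono-< {x} {y} x<y = 0<y-x⇒x<y (subst (0# <_) y-x≡-x--y (x<y⇒0<y-x x<y))
    where
    y-x≡-x--y : y - x ≡ - x - - y
    y-x≡-x--y = trans (+-comm y (- x)) (cong (_+_ (- x)) (sym (-‿involutive y)))

  neg-mono-≤ : ∀ {x y} → x ≤ y → - y ≤ - x
  neg-mono-≤ (inj₁ x<y) = inj₁ (neg-mono-< x<y)
  neg-mono-≤ (inj₂ refl) = ≤-refl

  x≤0⇒0≤-x : ∀ {x} → x ≤ 0# → 0# ≤ - x
  x≤0⇒0≤-x x≤0 = subst (_≤ _) -0#≈0# (neg-mono-≤ x≤0)

  0≤x⇒-x≤0 : ∀ {x} → 0# ≤ x → - x ≤ 0#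
  0≤x⇒-x≤0 0≤x = subst (_ ≤_) -0#≈0# (neg-mono-≤ 0≤x)

  0<x⇒-x<0 : ∀ {x} → 0# < x → - x < 0#
  0<x⇒-x<0 0<x = subst (_ <_) -0#≈0# (neg-mono-< 0<x)

  0<-x⇒x<0 : ∀ {x} → 0# < - x → x < 0#
  0<-x⇒x<0 {x} 0<-x = subst₂ _<_ (-‿involutive x) -0#≈0# (neg-mono-< 0<-x)

  x<0⇒0<-x : ∀ {x} → x < 0# → 0# < - x
  x<0⇒0<-x x<0 = subst (_< _) -0#≈0# (neg-mono-< x<0)

  *-monoʳ-< : ∀ {z x y} → 0# < z → x < y → z * x < z * y
  *-monoʳ-< {z} {x} {y} 0<z x<y = 0<y-x⇒x<y (subst (0# <_) z*[y-x] (0<* 0<z (x<y⇒0<y-x x<y)))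
    where
    z*[y-x] : z * (y - x) ≡ z * y - z * x
    z*[y-x] = trans (distribˡ z y (- x)) (cong (_+_ (z * y)) (sym (-‿distribʳ-* z x)))

  *-monoˡ-< : ∀ {z x y} → 0# < z → x < y → x * z < y * z
  *-monoˡ-< {z} {x} {y} 0<z x<y = subst₂ _<_ (*-comm z x) (*-comm z y) (*-monoʳ-< 0<z x<y)

  *-monoʳ-≤ : ∀ {z x y} → 0# ≤ z → x ≤ y → z * x ≤ z * y
  *-monoʳ-≤ (inj₁ 0<z) (inj₁ x<y) = inj₁ (*-monoʳ-< 0<z x<y)
  *-monoʳ-≤ {x = x} {y} (inj₂ refl) (inj₁ _) = inj₂ (trans (zeroˡ x) (sym (zeroˡ y)))
  *-monoʳ-≤ _ (inj₂ refl) = ≤-refl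

  *-monoˡ-≤ : ∀ {z x y} → 0# ≤ z → x ≤ y → x * z ≤ y * z
  *-monoˡ-≤ {z} {x} {y} 0≤z x≤y = subst₂ _≤_ (*-comm z x) (*-comm z y) (*-monoʳ-≤ 0≤z x≤y)

  *-mono-≤ : ∀ {x y u v} → 0# ≤ x → x ≤ y → 0# ≤ u → u ≤ v → x * u ≤ y * v
  *-mono-≤ 0≤x x≤y 0≤u u≤v = ≤-trans (*-monoʳ-≤ 0≤x u≤v) (*-monoˡ-≤ (≤-trans 0≤u u≤v) x≤y)

  *-mono-< : ∀ {x y u v} → 0# ≤ x → x < y → 0# ≤ u → u < v → x * u < y * v
  *-mono-< 0≤x x<y 0≤u u<v = ≤-<-trans (*-monoʳ-≤ 0≤x (<⇒≤ u<v)) (*-monoˡ-< (≤-<-trans 0≤u u<v) x<y)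

  *-cancelˡ-< : ∀ {z x y} → 0# ≤ z → z * x < z * y → x < y
  *-cancelˡ-< {z} {x} {y} 0≤z zx<zy with compare x y
  ... | tri< x<y _ _ = x<y
  ... | tri≈ _ refl _ = ⊥-elim (<-irrefl refl zx<zy)
  ... | tri> _ _ y<x = ⊥-elim (≤⇒≯ (*-monoʳ-≤ 0≤z (<⇒≤ y<x)) zx<zy)

  *-cancelʳ-< : ∀ {z x y} → 0# ≤ z → x * z < y * z → x < y
  *-cancelʳ-< {z} {x} {y} 0≤z xz<yz = *-cancelˡ-< 0≤z (subst₂ _<_ (*-comm x z) (*-comm y z) xz<yz)

  *-cancelˡ-≤ : ∀ {z x y} → 0# < z → z * x ≤ z * y → x ≤ y
  *-cancelˡ-≤ 0<z zx≤zy = ≮⇒≥ (λ y<x → ≤⇒≯ zx≤zy (*-monoʳ-< 0<z y<x))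

  0≤+ : ∀ {x y} → 0# ≤ x → 0# ≤ y → 0# ≤ x + y
  0≤+ 0≤x 0≤y = subst (_≤ _) (+-identityʳ 0#) (+-mono-≤ 0≤x 0≤y)

  0<+ : ∀ {x y} → 0# < x → 0# ≤ y → 0# < x + y
  0<+ 0<x 0≤y = subst (_< _) (+-identityʳ 0#) (+-mono-<-≤ 0<x 0≤y)

  0≤* : ∀ {x y} → 0# ≤ x → 0# ≤ y → 0# ≤ x * y
  0≤* {x} 0≤x 0≤y = subst (_≤ _) (zeroʳ x) (*-monoʳ-≤ 0≤x 0≤y)

  -x*-y≡x*y : ∀ x y → - x * - y ≡ x * y
  -x*-y≡x*y x y = trans (sym (-‿distribˡ-* x (- y))) (trans (cong -_ (sym (-‿distribʳ-* x y))) (-‿involutive (x * y)))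

  0<x*x : ∀ {x} → x ≢ 0# → 0# < x * x
  0<x*x {x} x≢0 with compare 0# x
  ... | tri< 0<x _ _ = 0<* 0<x 0<x
  ... | tri≈ _ 0≡x _ = ⊥-elim (x≢0 (sym 0≡x))
  ... | tri> _ _ x<0 = subst (0# <_) (-x*-y≡x*y x x) (0<* (x<0⇒0<-x x<0) (x<0⇒0<-x x<0))

  0≤x*x : ∀ x → 0# ≤ x * x
  0≤x*x x with compare 0# x
  ... | tri≈ _ refl _ = inj₂ (sym (zeroˡ 0#))
  ... | tri< _ 0≢x _ = inj₁ (0<x*x (0≢x ∘ sym))
  ... | tri> _ 0≢x _ = inj₁ (0<x*x (0≢x ∘ sym))

  x*x<y*y⇒x<y : ∀ {x y} → 0# ≤ y → x * x < y * y → x < y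
  x*x<y*y⇒x<y {x} {y} 0≤y xx<yy = ≰⇒> λ y≤x → ≤⇒≯ (*-mono-≤ 0≤y y≤x 0≤y y≤x) xx<yy

  *-pos-neg : ∀ {x y} → 0# < x → y < 0# → x * y < 0#
  *-pos-neg {x} {y} 0<x y<0 = subst (x * y <_) (zeroʳ x) (*-monoʳ-< 0<x y<0)

  *-neg-neg : ∀ {x y} → x < 0# → y < 0# → 0# < x * y
  *-neg-neg {x} {y} x<0 y<0 = subst (0# <_) (-x*-y≡x*y x y) (0<* (x<0⇒0<-x x<0) (x<0⇒0<-x y<0))

  x*x≡0⇒x≡0 : ∀ {x} → x * x ≡ 0# → x ≡ 0#
  x*x≡0⇒x≡0 {x} xx≡0 with compare x 0#
  ... | tri≈ _ x≡0 _ = x≡0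
  ... | tri< _ x≢0 _ = ⊥-elim (<-irrefl (sym xx≡0) (0<x*x x≢0))
  ... | tri> _ x≢0 _ = ⊥-elim (<-irrefl (sym xx≡0) (0<x*x x≢0))

  x≤y≤0⇒y*y≤x*x : ∀ {x y} → x ≤ y → y ≤ 0# → y * y ≤ x * x
  x≤y≤0⇒y*y≤x*x {x} {y} x≤y y≤0 =
    subst₂ _≤_ (-x*-y≡x*y y y) (-x*-y≡x*y x x) (*-mono-≤ 0≤-y -y≤-x 0≤-y -y≤-x)
    where
    0≤-y : 0# ≤ - y
    0≤-y = x≤0⇒0≤-x y≤0
    -y≤-x : - y ≤ - x
    -y≤-x = neg-mono-≤ x≤y

  ∣_∣ : Carrier → Carrier
  ∣ x ∣ with compare 0# x
  ... | tri> _ _ _ = - x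
  ... | _          = x

  0≤x⇒∣x∣≡x : ∀ {x} → 0# ≤ x → ∣ x ∣ ≡ x
  0≤x⇒∣x∣≡x {x} 0≤x with compare 0# x
  ... | tri< _ _ _ = refl
  ... | tri≈ _ _ _ = refl
  ... | tri> _ _ x<0 = ⊥-elim (≤⇒≯ 0≤x x<0)

  x≤0⇒∣x∣≡-x : ∀ {x} → x ≤ 0# → ∣ x ∣ ≡ - x
  x≤0⇒∣x∣≡-x {x} x≤0 with compare 0# x
  ... | tri< 0<x _ _ = ⊥-elim (≤⇒≯ x≤0 0<x)
  ... | tri≈ _ refl _ = sym -0#≈0#
  ... | tri> _ _ _ = refl

  0≤x⊎x≤0 : ∀ x → 0# ≤ x ⊎ x ≤ 0#
  0≤x⊎x≤0 x with compare 0# x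
  ... | tri< 0<x _ _ = inj₁ (inj₁ 0<x)
  ... | tri≈ _ 0≡x _ = inj₁ (inj₂ 0≡x)
  ... | tri> _ _ x<0 = inj₂ (inj₁ x<0)

  0≤∣x∣ : ∀ x → 0# ≤ ∣ x ∣
  0≤∣x∣ x with 0≤x⊎x≤0 x
  ... | inj₁ 0≤x = subst (0# ≤_) (sym (0≤x⇒∣x∣≡x 0≤x)) 0≤x
  ... | inj₂ x≤0 = subst (0# ≤_) (sym (x≤0⇒∣x∣≡-x x≤0)) (x≤0⇒0≤-x x≤0)

  x≤∣x∣ : ∀ x → x ≤ ∣ x ∣
  x≤∣x∣ x with 0≤x⊎x≤0 x
  ... | inj₁ 0≤x = inj₂ (sym (0≤x⇒∣x∣≡x 0≤x))
  ... | inj₂ x≤0 = ≤-trans x≤0 (0≤∣x∣ x)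

  -x≤∣x∣ : ∀ x → - x ≤ ∣ x ∣
  -x≤∣x∣ x with 0≤x⊎x≤0 x
  ... | inj₁ 0≤x = ≤-trans (0≤x⇒-x≤0 0≤x) (0≤∣x∣ x)
  ... | inj₂ x≤0 = inj₂ (sym (x≤0⇒∣x∣≡-x x≤0))

  ∣-x∣≡∣x∣ : ∀ x → ∣ - x ∣ ≡ ∣ x ∣
  ∣-x∣≡∣x∣ x with 0≤x⊎x≤0 x
  ... | inj₁ 0≤x = trans (x≤0⇒∣x∣≡-x (0≤x⇒-x≤0 0≤x)) (trans (-‿involutive x) (sym (0≤x⇒∣x∣≡x 0≤x)))
  ... | inj₂ x≤0 = trans (0≤x⇒∣x∣≡x (x≤0⇒0≤-x x≤0)) (sym (x≤0⇒∣x∣≡-x x≤0))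

  ∣x+y∣≤∣x∣+∣y∣ : ∀ x y → ∣ x + y ∣ ≤ ∣ x ∣ + ∣ y ∣
  ∣x+y∣≤∣x∣+∣y∣ x y with 0≤x⊎x≤0 (x + y)
  ... | inj₁ 0≤x+y = subst (_≤ ∣ x ∣ + ∣ y ∣) (sym (0≤x⇒∣x∣≡x 0≤x+y)) (+-mono-≤ (x≤∣x∣ x) (x≤∣x∣ y))
  ... | inj₂ x+y≤0 = subst (_≤ ∣ x ∣ + ∣ y ∣) (trans (-‿+-comm x y) (sym (x≤0⇒∣x∣≡-x x+y≤0)))
                           (+-mono-≤ (-x≤∣x∣ x) (-x≤∣x∣ y))

  ∣c*x∣≡c*∣x∣ : ∀ {c} x → 0# < c → ∣ c * x ∣ ≡ c * ∣ x ∣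
  ∣c*x∣≡c*∣x∣ {c} x 0<c with 0≤x⊎x≤0 x
  ... | inj₁ 0≤x = trans (0≤x⇒∣x∣≡x (0≤* (inj₁ 0<c) 0≤x)) (cong (c *_) (sym (0≤x⇒∣x∣≡x 0≤x)))
  ... | inj₂ x≤0 = trans (x≤0⇒∣x∣≡-x cx≤0) (trans (-‿distribʳ-* c x) (cong (c *_) (sym (x≤0⇒∣x∣≡-x x≤0))))
    where
    cx≤0 : c * x ≤ 0#
    cx≤0 = subst (c * x ≤_) (zeroʳ c) (*-monoʳ-≤ (inj₁ 0<c) x≤0)

ℤ-orderedCommutativeRing : OrderedCommutativeRing
ℤ-orderedCommutativeRing = record
  { isCommutativeRing    = ℤP.+-*-isCommutativeRing
  ; <-isStrictTotalOrder = ℤP.<-isStrictTotalOrder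
  ; +-monoˡ-<            = ℤP.+-monoˡ-<
  ; 0<1                  = ℤ.+<+ (s≤s z≤n)
  ; 0<*                  = 0<*
  }
  where
  0<* : ∀ {x y} → 0ℤ ℤ.< x → 0ℤ ℤ.< y → 0ℤ ℤ.< x ℤ.* y
  0<* {+[1+ _ ]} {+[1+ _ ]} _ _ = ℤ.+<+ (s≤s z≤n)
  0<* {+ 0} (ℤ.+<+ ())
  0<* {+[1+ _ ]} {+ 0} _ (ℤ.+<+ ())


module IntegerOrder where

  open import Data.Integer using (_+_; _*_; _-_; -_)
  open OrderedCommutativeRingProperties ℤ-orderedCommutativeRing public
    hiding (Carrier; _+_; _*_; -_; _-_; 0#; 1#)

  fromℤ≤ : ∀ {i j} → i ℤ.≤ j → i ≤ j
  fromℤ≤ {i} {j} i≤j with compare i j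
  ... | tri< i<j _ _ = inj₁ i<j
  ... | tri≈ _ i≡j _ = inj₂ i≡j
  ... | tri> _ _ j<i = ⊥-elim (ℤP.≤⇒≯ i≤j j<i)

  toℤ≤ : ∀ {i j} → i ≤ j → i ℤ.≤ j
  toℤ≤ (inj₁ i<j) = ℤP.<⇒≤ i<j
  toℤ≤ (inj₂ refl) = ℤP.≤-refl

  ≤ᵇ-reflects-≤ : ∀ i j → Reflects (i ≤ j) (i ℤ.≤ᵇ j)
  ≤ᵇ-reflects-≤ i j = fromEquivalence (fromℤ≤ ∘ ℤP.≤ᵇ⇒≤) (ℤP.≤⇒≤ᵇ ∘ toℤ≤)

  <ᶻ-reflects-< : ∀ i j → Reflects (i < j) (i <ᶻ j)
  <ᶻ-reflects-< i j = reflects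
    where
    reflects : Reflects (i < j) (not (j ℤ.≤ᵇ i))
    reflects with j ℤ.≤ᵇ i | ≤ᵇ-reflects-≤ j i
    ... | true  | ofʸ j≤i = ofⁿ (≤⇒≯ j≤i)
    ... | false | ofⁿ j≰i = ofʸ (≰⇒> j≰i)

  private
    descent-identity : ∀ d n p q →
      (d * q - n * p) * (d * q - n * p) - (p - n * q) * (p - n * q) * d ≡ (d - n * n) * (q * q * d - p * p)
    descent-identity = solve-∀

    square-factor : ∀ x y → x * x * (y * y) ≡ (x * y) * (x * y)
    square-factor = solve-∀

    d-square-factor : ∀ d q → d * (q * q * d) ≡ d * q * (d * q)
    d-square-factor = solve-∀

    descent-gap : ∀ n p q → (n + 1ℤ) * q - p ≡ q - (p - n * q)
    descent-gap = solve-∀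

  module _ {D n : ℤ} (0≤n : 0ℤ ≤ n) (n²<D : n * n < D) (D<[n+1]² : D < (n + 1ℤ) * (n + 1ℤ)) where

    private
      0<D : 0ℤ < D
      0<D = ≤-<-trans (0≤x*x n) n²<D

    -- A rational square root p/q of D, where n < √D < n + 1, yields the smaller
    -- one (Dq - np)/(p - nq).
    descent : ∀ {p q} → Acc ℕ._<_ ℤ.∣ q ∣ → 0ℤ < q → 0ℤ ≤ p → p * p ≢ q * q * D
    descent {p} {q} (acc smaller) 0<q 0≤p p²≡q²D =
      descent (smaller ∣q′∣<∣q∣) 0<q′ (<⇒≤ 0<p′) p′²≡q′²D
      where
      open ≤-Reasoning
      q′ p′ : ℤ
      q′ = p - n * q
      p′ = D * q - n * p

      0<q² : 0ℤ < q * q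
      0<q² = 0<* 0<q 0<q

      nq<p : n * q < p
      nq<p = x*x<y*y⇒x<y 0≤p (begin-strict
        n * q * (n * q)  ≡⟨ square-factor n q ⟨
        n * n * (q * q)  <⟨ *-monoˡ-< 0<q² n²<D ⟩
        D * (q * q)      ≡⟨ trans (*-comm D (q * q)) (sym p²≡q²D) ⟩
        p * p            ∎)

      p<[n+1]q : p < (n + 1ℤ) * q
      p<[n+1]q = x*x<y*y⇒x<y (0≤* (0≤+ 0≤n (inj₁ 0<1)) (inj₁ 0<q)) (begin-strict
        p * p                          ≡⟨ trans p²≡q²D (*-comm (q * q) D) ⟩
        D * (q * q)                    <⟨ *-monoˡ-< 0<q² D<[n+1]² ⟩
        (n + 1ℤ) * (n + 1ℤ) * (q * q)  ≡⟨ square-factor (n + 1ℤ) q ⟩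
        (n + 1ℤ) * q * ((n + 1ℤ) * q)  ∎)

      0<p : 0ℤ < p
      0<p = ≤-<-trans (0≤* 0≤n (inj₁ 0<q)) nq<p

      np<Dq : n * p < D * q
      np<Dq = x*x<y*y⇒x<y (0≤* (inj₁ 0<D) (inj₁ 0<q)) (begin-strict
        n * p * (n * p)  ≡⟨ square-factor n p ⟨
        n * n * (p * p)  <⟨ *-monoˡ-< (0<* 0<p 0<p) n²<D ⟩
        D * (p * p)      ≡⟨ cong (D *_) p²≡q²D ⟩
        D * (q * q * D)  ≡⟨ d-square-factor D q ⟩
        D * q * (D * q)  ∎)

      0<q′ : 0ℤ < q′
      0<q′ = x<y⇒0<y-x nq<p

      0<p′ : 0ℤ < p′
      0<p′ = x<y⇒0<y-x np<Dq

      q′<q : q′ < q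
      q′<q = 0<y-x⇒x<y (subst (0ℤ <_) (descent-gap n p q) (x<y⇒0<y-x p<[n+1]q))

      ∣q′∣<∣q∣ : ℤ.∣ q′ ∣ ℕ.< ℤ.∣ q ∣
      ∣q′∣<∣q∣ = ℤP.drop‿+<+ (subst₂ _<_ (+∣i∣≡i 0<q′) (+∣i∣≡i 0<q) q′<q)
        where
        +∣i∣≡i : ∀ {i} → 0ℤ < i → i ≡ + ℤ.∣ i ∣
        +∣i∣≡i 0<i = sym (ℤP.0≤i⇒+∣i∣≡i (ℤP.<⇒≤ 0<i))

      p′²≡q′²D : p′ * p′ ≡ q′ * q′ * D
      p′²≡q′²D = ℤP.i-j≡0⇒i≡j _ _ (begin-equality
        p′ * p′ - q′ * q′ * D               ≡⟨ descent-identity D n p q ⟩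
        (D - n * n) * (q * q * D - p * p)   ≡⟨ cong ((D - n * n) *_) (ℤP.i≡j⇒i-j≡0 (sym p²≡q²D)) ⟩
        (D - n * n) * 0ℤ                    ≡⟨ ℤP.*-zeroʳ (D - n * n) ⟩
        0ℤ                                  ∎)

    private
      no-root-over : ∀ {q} → 0ℤ < q → ∀ p → p * p ≢ q * q * D
      no-root-over 0<q p with compare 0ℤ p
      ... | tri< 0<p _ _ = descent (<-wellFounded _) 0<q (inj₁ 0<p)
      ... | tri≈ _ refl _ = descent (<-wellFounded _) 0<q ≤-refl
      ... | tri> _ _ p<0 = descent (<-wellFounded _) 0<q (inj₁ (x<0⇒0<-x p<0)) ∘ trans (-x*-y≡x*y p p)

    √-irrational : ∀ p q → p * p ≡ q * q * D → q ≡ 0ℤ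
    √-irrational p q p²≡q²D with compare 0ℤ q
    ... | tri< 0<q _ _ = ⊥-elim (no-root-over 0<q p p²≡q²D)
    ... | tri≈ _ 0≡q _ = sym 0≡q
    ... | tri> _ _ q<0 =
      ⊥-elim (no-root-over (x<0⇒0<-x q<0) p (trans p²≡q²D (cong (_* D) (sym (-x*-y≡x*y q q)))))

module QuadraticSurd (D : ℤ) (0<D : 0ℤ ℤ.< D)
                     (√D-irrational : ∀ p q → p ℤ.* p ≡ q ℤ.* q ℤ.* D → q ≡ 0ℤ) where

  open import Data.Integer using (_+_; _*_; _-_; -_)
  open IntegerOrder

  -- ⟪ p , q ⟫ stands for the real number p + q√D.
  data Surd : Set where
    ⟪_,_⟫ : ℤ → ℤ → Surd

  private
    norm-⊗ : ∀ p q r s d →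
      (p * r + q * s * d) * (p * r + q * s * d) - (p * s + q * r) * (p * s + q * r) * d
        ≡ (p * p - q * q * d) * (r * r - s * s * d)
    norm-⊗ = solve-∀

    norm-⊕ : ∀ p q r s d →
      (p + r) * (p + r) - (q + s) * (q + s) * d
        ≡ (p * p - q * q * d) + (r * r - s * s * d) + (p * r - q * s * d) + (p * r - q * s * d)
    norm-⊕ = solve-∀

    norm-⊕-surd : ∀ p q r s d →
      (q + s) * (q + s) * d - (p + r) * (p + r)
        ≡ (q * q * d - p * p) + (s * s * d - r * r) + (q * s * d - p * r) + (q * s * d - p * r)
    norm-⊕-surd = solve-∀

    square-factor : ∀ x y → x * y * (x * y) * 1ℤ ≡ x * x * (y * y)
    square-factor = solve-∀

    square-neg-factor : ∀ x y → - (x * y) * - (x * y) * 1ℤ ≡ x * x * (y * y)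
    square-neg-factor = solve-∀

    square-factor-d : ∀ x y d → x * y * d * (x * y * d) * 1ℤ ≡ x * x * d * (y * y * d)
    square-factor-d = solve-∀

    square-neg-factor-d : ∀ x y d → - (x * y * d) * - (x * y * d) * 1ℤ ≡ x * x * d * (y * y * d)
    square-neg-factor-d = solve-∀

    square-factor-k : ∀ x y d → x * y * (x * y) * d ≡ x * x * (y * y * d)
    square-factor-k = solve-∀

    square-neg-factor-k : ∀ x y d → - (x * y) * - (x * y) * d ≡ x * x * d * (y * y)
    square-neg-factor-k = solve-∀

  infixl 6 _⊕_
  infixl 7 _⊗_
  infix  8 ⊖_

  _⊕_ _⊗_ : Surd → Surd → Surd
  ⟪ p , q ⟫ ⊕ ⟪ r , s ⟫ = ⟪ p + r , q + s ⟫
  ⟪ p , q ⟫ ⊗ ⟪ r , s ⟫ = ⟪ p * r + q * s * D , p * s + q * r ⟫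

  ⊖_ : Surd → Surd
  ⊖ ⟪ p , q ⟫ = ⟪ - p , - q ⟫

  -- p + q√D > 0 iff the larger of |p| and |q|√D (never equal, √D being irrational)
  -- has a positive coefficient.
  data Positive : Surd → Set where
    rational-dominant : ∀ {p q} → 0ℤ < p → q * q * D < p * p → Positive ⟪ p , q ⟫
    surd-dominant     : ∀ {p q} → 0ℤ < q → p * p < q * q * D → Positive ⟪ p , q ⟫

  private
    0≤q²D : ∀ q → 0ℤ ≤ q * q * D
    0≤q²D q = 0≤* (0≤x*x q) (inj₁ 0<D)

    cross-term-< : ∀ {x y a b c d k} → 0ℤ < k → 0ℤ ≤ y → 0ℤ ≤ a → a < c → 0ℤ ≤ b → b < d →
                   x * x * k ≡ a * b → y * y * k ≡ c * d → x < y
    cross-term-< 0<k 0≤y 0≤a a<c 0≤b b<d x²k≡ab y²k≡cd =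
      x*x<y*y⇒x<y 0≤y (*-cancelʳ-< (inj₁ 0<k) (subst₂ _<_ (sym x²k≡ab) (sym y²k≡cd) (*-mono-< 0≤a a<c 0≤b b<d)))

  ⊗-comm : ∀ ξ η → ξ ⊗ η ≡ η ⊗ ξ
  ⊗-comm ⟪ p , q ⟫ ⟪ r , s ⟫ = cong₂ ⟪_,_⟫ (rat p q r s D) (irr p q r s)
    where
    rat : ∀ p q r s d → p * r + q * s * d ≡ r * p + s * q * d
    rat = solve-∀
    irr : ∀ p q r s → p * s + q * r ≡ r * q + s * p
    irr = solve-∀

  ⊗-positive : ∀ {ξ η} → Positive ξ → Positive η → Positive (ξ ⊗ η)
  ⊗-positive {⟪ p , q ⟫} {⟪ r , s ⟫} (rational-dominant 0<p q²D<p²) (rational-dominant 0<r s²D<r²) =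
    rational-dominant (-x<y⇒0<y+x -qsD<pr)
      (0<y-x⇒x<y (subst (0ℤ <_) (sym (norm-⊗ p q r s D)) (0<* (x<y⇒0<y-x q²D<p²) (x<y⇒0<y-x s²D<r²))))
    where
    -qsD<pr : - (q * s * D) < p * r
    -qsD<pr = cross-term-< 0<1 (inj₁ (0<* 0<p 0<r)) (0≤q²D q) q²D<p² (0≤q²D s) s²D<r²
                (square-neg-factor-d q s D) (square-factor p r)
  ⊗-positive {⟪ p , q ⟫} {⟪ r , s ⟫} (rational-dominant 0<p q²D<p²) (surd-dominant 0<s r²<s²D) =
    surd-dominant (-x<y⇒0<y+x -qr<ps)
      (x-y<0⇒x<y (subst (_< 0ℤ) (sym (norm-⊗ p q r s D)) (*-pos-neg (x<y⇒0<y-x q²D<p²) (x<y⇒x-y<0 r²<s²D))))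
    where
    -qr<ps : - (q * r) < p * s
    -qr<ps = cross-term-< 0<D (inj₁ (0<* 0<p 0<s)) (0≤q²D q) q²D<p² (0≤x*x r) r²<s²D
                (square-neg-factor-k q r D) (square-factor-k p s D)
  ⊗-positive {ξ} {η} ξ>0@(surd-dominant _ _) η>0@(rational-dominant _ _) =
    subst Positive (⊗-comm η ξ) (⊗-positive η>0 ξ>0)
  ⊗-positive {⟪ p , q ⟫} {⟪ r , s ⟫} (surd-dominant 0<q p²<q²D) (surd-dominant 0<s r²<s²D) =
    rational-dominant (subst (0ℤ <_) (ℤP.+-comm (q * s * D) (p * r)) (-x<y⇒0<y+x -pr<qsD))
      (0<y-x⇒x<y (subst (0ℤ <_) (sym (norm-⊗ p q r s D)) (*-neg-neg (x<y⇒x-y<0 p²<q²D) (x<y⇒x-y<0 r²<s²D))))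
    where
    -pr<qsD : - (p * r) < q * s * D
    -pr<qsD = cross-term-< 0<1 (inj₁ (0<* (0<* 0<q 0<s) 0<D)) (0≤x*x p) p²<q²D (0≤x*x r) r²<s²D
                (square-neg-factor p r) (square-factor-d q s D)

  ¬positive-0 : ¬ Positive ⟪ 0ℤ , 0ℤ ⟫
  ¬positive-0 (rational-dominant 0<0 _) = <-irrefl refl 0<0
  ¬positive-0 (surd-dominant 0<0 _) = <-irrefl refl 0<0

  positive-asym : ∀ {ξ} → Positive ξ → ¬ Positive (⊖ ξ)
  positive-asym (rational-dominant 0<p _) (rational-dominant 0<-p _) = <-asym 0<p (0<-x⇒x<0 0<-p)
  positive-asym (surd-dominant 0<q _) (surd-dominant 0<-q _) = <-asym 0<q (0<-x⇒x<0 0<-q)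
  positive-asym {⟪ p , q ⟫} (rational-dominant _ q²D<p²) (surd-dominant _ p²<q²D) =
    <-asym q²D<p² (subst₂ _<_ (-x*-y≡x*y p p) (cong (_* D) (-x*-y≡x*y q q)) p²<q²D)
  positive-asym {⟪ p , q ⟫} (surd-dominant _ p²<q²D) (rational-dominant _ q²D<p²) =
    <-asym p²<q²D (subst₂ _<_ (cong (_* D) (-x*-y≡x*y q q)) (-x*-y≡x*y p p) q²D<p²)

  positive-trichotomy : ∀ ξ → ξ ≡ ⟪ 0ℤ , 0ℤ ⟫ ⊎ Positive ξ ⊎ Positive (⊖ ξ)
  positive-trichotomy ⟪ p , q ⟫ with compare (q * q * D) (p * p) | compare 0ℤ p | compare 0ℤ q
  ... | tri< q²D<p² _ _ | tri< 0<p _ _ | _ = inj₂ (inj₁ (rational-dominant 0<p q²D<p²))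
  ... | tri< q²D<p² _ _ | tri> _ _ p<0 | _ =
    inj₂ (inj₂ (rational-dominant (x<0⇒0<-x p<0)
      (subst₂ _<_ (cong (_* D) (sym (-x*-y≡x*y q q))) (sym (-x*-y≡x*y p p)) q²D<p²)))
  ... | tri< q²D<p² _ _ | tri≈ _ refl _ | _ = ⊥-elim (≤⇒≯ (0≤q²D q) q²D<p²)
  ... | tri> _ _ p²<q²D | _ | tri< 0<q _ _ = inj₂ (inj₁ (surd-dominant 0<q p²<q²D))
  ... | tri> _ _ p²<q²D | _ | tri> _ _ q<0 =
    inj₂ (inj₂ (surd-dominant (x<0⇒0<-x q<0)
      (subst₂ _<_ (sym (-x*-y≡x*y p p)) (cong (_* D) (sym (-x*-y≡x*y q q))) p²<q²D)))
  ... | tri> _ _ p²<q²D | _ | tri≈ _ refl _ = ⊥-elim (≤⇒≯ (0≤x*x p) p²<q²D)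
  ... | tri≈ _ q²D≡p² _ | _ | _ = inj₁ (cong₂ ⟪_,_⟫ p≡0 q≡0)
    where
    q≡0 : q ≡ 0ℤ
    q≡0 = √D-irrational p q (sym q²D≡p²)
    p≡0 : p ≡ 0ℤ
    p≡0 = x*x≡0⇒x≡0 (trans (sym q²D≡p²) (cong (λ q → q * q * D) q≡0))

  ⊗-cancelʳ-positive : ∀ {ζ ξ} → Positive (ζ ⊗ ξ) → Positive ξ → Positive ζ
  ⊗-cancelʳ-positive {ζ} {ξ} ζξ>0 ξ>0 with positive-trichotomy ζ
  ... | inj₁ refl = ⊥-elim (¬positive-0 (subst Positive (0⊗ ξ) ζξ>0))
    where
    0⊗ : ∀ ξ → ⟪ 0ℤ , 0ℤ ⟫ ⊗ ξ ≡ ⟪ 0ℤ , 0ℤ ⟫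
    0⊗ ⟪ r , s ⟫ = refl
  ... | inj₂ (inj₁ ζ>0) = ζ>0
  ... | inj₂ (inj₂ ⊖ζ>0) = ⊥-elim (positive-asym ζξ>0 (subst Positive (⊖-⊗ ζ ξ) (⊗-positive ⊖ζ>0 ξ>0)))
    where
    ⊖-⊗ : ∀ ζ ξ → ⊖ ζ ⊗ ξ ≡ ⊖ (ζ ⊗ ξ)
    ⊖-⊗ ⟪ p , q ⟫ ⟪ r , s ⟫ = cong₂ ⟪_,_⟫ (rat p q r s D) (irr p q r s)
      where
      rat : ∀ p q r s d → - p * r + - q * s * d ≡ - (p * r + q * s * d)
      rat = solve-∀
      irr : ∀ p q r s → - p * s + - q * r ≡ - (p * s + q * r)
      irr = solve-∀

  positive-nonneg-parts : ∀ {p q} → 0ℤ ≤ p → 0ℤ < q → Positive ⟪ p , q ⟫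
  positive-nonneg-parts {p} {q} 0≤p 0<q with compare (q * q * D) (p * p)
  ... | tri> _ _ p²<q²D = surd-dominant 0<q p²<q²D
  ... | tri≈ _ q²D≡p² _ = ⊥-elim (<-irrefl (sym (√D-irrational p q (sym q²D≡p²))) 0<q)
  ... | tri< q²D<p² _ _ with 0≤p
  ...   | inj₁ 0<p = rational-dominant 0<p q²D<p²
  ...   | inj₂ refl = ⊥-elim (≤⇒≯ (0≤q²D q) q²D<p²)

  private

    ⊕-positive-rational-dominant : ∀ {p q r s} → 0ℤ < p → q * q * D < p * p → 0ℤ < r → s * s * D < r * r →
                                   Positive (⟪ p , q ⟫ ⊕ ⟪ r , s ⟫)
    ⊕-positive-rational-dominant {p} {q} {r} {s} 0<p q²D<p² 0<r s²D<r² =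
      rational-dominant (0<+ 0<p (inj₁ 0<r)) (0<y-x⇒x<y (subst (0ℤ <_) (sym (norm-⊕ p q r s D))
        (0<+ (0<+ (0<+ (x<y⇒0<y-x q²D<p²) (inj₁ (x<y⇒0<y-x s²D<r²))) (inj₁ 0<pr-qsD)) (inj₁ 0<pr-qsD))))
      where
      0<pr-qsD : 0ℤ < p * r - q * s * D
      0<pr-qsD = x<y⇒0<y-x (cross-term-< 0<1 (inj₁ (0<* 0<p 0<r)) (0≤q²D q) q²D<p² (0≤q²D s) s²D<r²
                              (square-factor-d q s D) (square-factor p r))

    ⊕-positive-surd-dominant : ∀ {p q r s} → 0ℤ < q → p * p < q * q * D → 0ℤ < s → r * r < s * s * D →
                               Positive (⟪ p , q ⟫ ⊕ ⟪ r , s ⟫)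
    ⊕-positive-surd-dominant {p} {q} {r} {s} 0<q p²<q²D 0<s r²<s²D =
      surd-dominant (0<+ 0<q (inj₁ 0<s)) (0<y-x⇒x<y (subst (0ℤ <_) (sym (norm-⊕-surd p q r s D))
        (0<+ (0<+ (0<+ (x<y⇒0<y-x p²<q²D) (inj₁ (x<y⇒0<y-x r²<s²D))) (inj₁ 0<qsD-pr)) (inj₁ 0<qsD-pr))))
      where
      0<qsD-pr : 0ℤ < q * s * D - p * r
      0<qsD-pr = x<y⇒0<y-x (cross-term-< 0<1 (inj₁ (0<* (0<* 0<q 0<s) 0<D)) (0≤x*x p) p²<q²D (0≤x*x r) r²<s²D
                              (square-factor p r) (square-factor-d q s D))

    shift-positive : ∀ {n η} → 0ℤ < n → Positive η → Positive (⟪ n , 0ℤ ⟫ ⊕ η)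
    shift-positive {n} {⟪ p , q ⟫} 0<n (rational-dominant 0<p q²D<p²) =
      ⊕-positive-rational-dominant {n} {0ℤ} {p} {q} 0<n (subst (_< n * n) (sym (ℤP.*-zeroˡ D)) (0<* 0<n 0<n)) 0<p q²D<p²
    shift-positive {n} {⟪ p , q ⟫} 0<n (surd-dominant 0<q p²<q²D)
      rewrite ℤP.+-identityˡ q with compare (q * q * D) ((n + p) * (n + p))
    ... | tri> _ _ [n+p]²<q²D = surd-dominant 0<q [n+p]²<q²D
    ... | tri≈ _ q²D≡[n+p]² _ = ⊥-elim (<-irrefl (sym (√D-irrational (n + p) q (sym q²D≡[n+p]²))) 0<q)
    ... | tri< q²D<[n+p]² _ _ = rational-dominant (≰⇒> n+p≰0) q²D<[n+p]²
      where
      n+p≰0 : ¬ (n + p ≤ 0ℤ)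
      n+p≰0 n+p≤0 = <-asym q²D<[n+p]² (≤-<-trans (x≤y≤0⇒y*y≤x*x p≤n+p n+p≤0) p²<q²D)
        where
        p≤n+p : p ≤ n + p
        p≤n+p = inj₁ (subst (_< n + p) (ℤP.+-identityˡ p) (+-monoˡ-< p 0<n))

  ⊕-comm : ∀ ξ η → ξ ⊕ η ≡ η ⊕ ξ
  ⊕-comm ⟪ p , q ⟫ ⟪ r , s ⟫ = cong₂ ⟪_,_⟫ (ℤP.+-comm p r) (ℤP.+-comm q s)

  ⊕-positive : ∀ {ξ η} → Positive ξ → Positive η → Positive (ξ ⊕ η)
  ⊕-positive {⟪ p , q ⟫} {⟪ r , s ⟫} (rational-dominant 0<p q²D<p²) (rational-dominant 0<r s²D<r²) =
    ⊕-positive-rational-dominant {p} {q} {r} {s} 0<p q²D<p² 0<r s²D<r²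
  ⊕-positive {⟪ p , q ⟫} {⟪ r , s ⟫} (surd-dominant 0<q p²<q²D) (surd-dominant 0<s r²<s²D) =
    ⊕-positive-surd-dominant {p} {q} {r} {s} 0<q p²<q²D 0<s r²<s²D
  ⊕-positive {ξ} {η} ξ>0@(surd-dominant _ _) η>0@(rational-dominant _ _) =
    subst Positive (⊕-comm η ξ) (⊕-positive η>0 ξ>0)
  -- With ξ = p + q√D and ξ̄ = p - q√D (also positive), (ξ + η)ξ̄ = (p² - q²D) + ηξ̄ is a
  -- positive rational plus a positive number.
  ⊕-positive {⟪ p , q ⟫} {η@(⟪ r , s ⟫)} (rational-dominant 0<p q²D<p²) η>0@(surd-dominant _ _) =
    ⊗-cancelʳ-positive
      (subst Positive (sym [ξ+η]ξ̄≡) (shift-positive (x<y⇒0<y-x q²D<p²) (⊗-positive η>0 ξ̄>0))) ξ̄>0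
    where
    ξ̄>0 : Positive ⟪ p , - q ⟫
    ξ̄>0 = rational-dominant 0<p (subst (_< p * p) (cong (_* D) (sym (-x*-y≡x*y q q))) q²D<p²)
    [ξ+η]ξ̄≡ : ⟪ p + r , q + s ⟫ ⊗ ⟪ p , - q ⟫ ≡ ⟪ p * p - q * q * D , 0ℤ ⟫ ⊕ ⟪ r , s ⟫ ⊗ ⟪ p , - q ⟫
    [ξ+η]ξ̄≡ = cong₂ ⟪_,_⟫ (rat p q r s D) (irr p q r s)
      where
      rat : ∀ p q r s d → (p + r) * p + (q + s) * - q * d ≡ (p * p - q * q * d) + (r * p + s * - q * d)
      rat = solve-∀
      irr : ∀ p q r s → (p + r) * - q + (q + s) * p ≡ 0ℤ + (r * - q + s * p)
      irr = solve-∀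

  -- The test isPos applies to 2α = u + q√D.
  positive? : Surd → Bool
  positive? ⟪ u , q ⟫ =
    if 0ℤ <ᶻ q then (0ℤ ℤ.≤ᵇ u) ∨ (u * u <ᶻ q * q * D)
    else if q <ᶻ 0ℤ then (0ℤ <ᶻ u) ∧ (q * q * D <ᶻ u * u)
    else 0ℤ <ᶻ u

  positive?-sound : ∀ ξ → T (positive? ξ) → Positive ξ
  positive?-sound ⟪ u , q ⟫ h with 0ℤ <ᶻ q | <ᶻ-reflects-< 0ℤ q
  positive?-sound ⟪ u , q ⟫ h | true | ofʸ 0<q with 0ℤ ℤ.≤ᵇ u | ≤ᵇ-reflects-≤ 0ℤ u
  ... | true  | ofʸ 0≤u = positive-nonneg-parts 0≤u 0<q
  ... | false | ofⁿ _ with u * u <ᶻ q * q * D | <ᶻ-reflects-< (u * u) (q * q * D)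
  ...   | true | ofʸ u²<q²D = surd-dominant 0<q u²<q²D
  positive?-sound ⟪ u , q ⟫ h | false | ofⁿ 0≮q with q <ᶻ 0ℤ | <ᶻ-reflects-< q 0ℤ
  ... | true | ofʸ q<0 with 0ℤ <ᶻ u | <ᶻ-reflects-< 0ℤ u | q * q * D <ᶻ u * u | <ᶻ-reflects-< (q * q * D) (u * u)
  ...   | true | ofʸ 0<u | true | ofʸ q²D<u² = rational-dominant 0<u q²D<u²
  positive?-sound ⟪ u , q ⟫ h | false | ofⁿ 0≮q | false | ofⁿ q≮0 with 0ℤ <ᶻ u | <ᶻ-reflects-< 0ℤ u
  ... | true | ofʸ 0<u = rational-dominant 0<u (subst (_< u * u) (sym q²D≡0) (0<* 0<u 0<u))
    where
    q²D≡0 : q * q * D ≡ 0ℤ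
    q²D≡0 = trans (cong (λ q → q * q * D) (≤-antisym (≮⇒≥ 0≮q) (≮⇒≥ q≮0))) (ℤP.*-zeroˡ D)

  positive?-complete : ∀ {ξ} → Positive ξ → T (positive? ξ)
  positive?-complete {⟪ u , q ⟫} ξ>0 with 0ℤ <ᶻ q | <ᶻ-reflects-< 0ℤ q
  positive?-complete {⟪ u , q ⟫} ξ>0 | true | ofʸ 0<q with 0ℤ ℤ.≤ᵇ u | ≤ᵇ-reflects-≤ 0ℤ u | ξ>0
  ... | true  | _      | _ = tt
  ... | false | ofⁿ 0≰u | rational-dominant 0<u _ = ⊥-elim (0≰u (inj₁ 0<u))
  ... | false | ofⁿ _   | surd-dominant _ u²<q²D with u * u <ᶻ q * q * D | <ᶻ-reflects-< (u * u) (q * q * D)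
  ...   | true  | _ = tt
  ...   | false | ofⁿ u²≮q²D = ⊥-elim (u²≮q²D u²<q²D)
  positive?-complete {⟪ u , q ⟫} (surd-dominant 0<q _) | false | ofⁿ 0≮q = ⊥-elim (0≮q 0<q)
  positive?-complete {⟪ u , q ⟫} (rational-dominant 0<u q²D<u²) | false | ofⁿ _
    with q <ᶻ 0ℤ | <ᶻ-reflects-< q 0ℤ | 0ℤ <ᶻ u | <ᶻ-reflects-< 0ℤ u
  ... | _ | _ | false | ofⁿ 0≮u = ⊥-elim (0≮u 0<u)
  ... | false | _ | true | _ = tt
  ... | true | _ | true | _ with q * q * D <ᶻ u * u | <ᶻ-reflects-< (q * q * D) (u * u)
  ...   | true  | _ = tt
  ...   | false | ofⁿ q²D≮u² = ⊥-elim (q²D≮u² q²D<u²)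

module ZθRing (a : ℕ) where
  open Q a

  Zθ-isCommutativeRing : IsCommutativeRing _≡_ _+_ _*_ -_ 𝟘 𝟙
  Zθ-isCommutativeRing = record
    { isRing = record
      { +-isAbelianGroup = record
        { isGroup = record
          { isMonoid = record
            { isSemigroup = record
              { isMagma = record { isEquivalence = isEquivalence ; ∙-cong = cong₂ _+_ }
              ; assoc = +-assoc }
            ; identity = +-identityˡ , +-identityʳ }
          ; inverse = -‿inverseˡ , -‿inverseʳ
          ; ⁻¹-cong = cong (-_) }
        ; comm = +-comm }
      ; *-cong = cong₂ _*_
      ; *-assoc = *-assoc
      ; *-identity = *-identityˡ , *-identityʳ
      ; distrib = distribˡ , distribʳ }
    ; *-comm = *-comm }
    where
    +-assoc : ∀ α β γ → α + β + γ ≡ α + (β + γ)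
    +-assoc ⟨ x , y ⟩ ⟨ u , v ⟩ ⟨ s , t ⟩ = cong₂ ⟨_,_⟩ (ℤP.+-assoc x u s) (ℤP.+-assoc y v t)
    +-comm : ∀ α β → α + β ≡ β + α
    +-comm ⟨ x , y ⟩ ⟨ u , v ⟩ = cong₂ ⟨_,_⟩ (ℤP.+-comm x u) (ℤP.+-comm y v)
    +-identityˡ : ∀ α → 𝟘 + α ≡ α
    +-identityˡ ⟨ x , y ⟩ = cong₂ ⟨_,_⟩ (ℤP.+-identityˡ x) (ℤP.+-identityˡ y)
    +-identityʳ : ∀ α → α + 𝟘 ≡ α
    +-identityʳ ⟨ x , y ⟩ = cong₂ ⟨_,_⟩ (ℤP.+-identityʳ x) (ℤP.+-identityʳ y)
    -‿inverseˡ : ∀ α → - α + α ≡ 𝟘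
    -‿inverseˡ ⟨ x , y ⟩ = cong₂ ⟨_,_⟩ (ℤP.+-inverseˡ x) (ℤP.+-inverseˡ y)
    -‿inverseʳ : ∀ α → α - α ≡ 𝟘
    -‿inverseʳ ⟨ x , y ⟩ = cong₂ ⟨_,_⟩ (ℤP.+-inverseʳ x) (ℤP.+-inverseʳ y)
    *-assoc : ∀ α β γ → α * β * γ ≡ α * (β * γ)
    *-assoc ⟨ x , y ⟩ ⟨ u , v ⟩ ⟨ s , t ⟩ = cong₂ ⟨_,_⟩ (on-re A x y u v s t) (on-im A x y u v s t)
      where
      on-re : ∀ k x y u v s t →
        (x ℤ.* u ℤ.- y ℤ.* v) ℤ.* s ℤ.- (x ℤ.* v ℤ.+ y ℤ.* u ℤ.+ k ℤ.* y ℤ.* v) ℤ.* t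
          ≡ x ℤ.* (u ℤ.* s ℤ.- v ℤ.* t) ℤ.- y ℤ.* (u ℤ.* t ℤ.+ v ℤ.* s ℤ.+ k ℤ.* v ℤ.* t)
      on-re = solve-∀
      on-im : ∀ k x y u v s t →
        (x ℤ.* u ℤ.- y ℤ.* v) ℤ.* t ℤ.+ (x ℤ.* v ℤ.+ y ℤ.* u ℤ.+ k ℤ.* y ℤ.* v) ℤ.* s
          ℤ.+ k ℤ.* (x ℤ.* v ℤ.+ y ℤ.* u ℤ.+ k ℤ.* y ℤ.* v) ℤ.* t
          ≡ x ℤ.* (u ℤ.* t ℤ.+ v ℤ.* s ℤ.+ k ℤ.* v ℤ.* t) ℤ.+ y ℤ.* (u ℤ.* s ℤ.- v ℤ.* t)
            ℤ.+ k ℤ.* y ℤ.* (u ℤ.* t ℤ.+ v ℤ.* s ℤ.+ k ℤ.* v ℤ.* t)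
      on-im = solve-∀
    *-comm : ∀ α β → α * β ≡ β * α
    *-comm ⟨ x , y ⟩ ⟨ u , v ⟩ = cong₂ ⟨_,_⟩ (on-re x y u v) (on-im A x y u v)
      where
      on-re : ∀ x y u v → x ℤ.* u ℤ.- y ℤ.* v ≡ u ℤ.* x ℤ.- v ℤ.* y
      on-re = solve-∀
      on-im : ∀ k x y u v → x ℤ.* v ℤ.+ y ℤ.* u ℤ.+ k ℤ.* y ℤ.* v ≡ u ℤ.* y ℤ.+ v ℤ.* x ℤ.+ k ℤ.* v ℤ.* y
      on-im = solve-∀
    *-identityˡ : ∀ α → 𝟙 * α ≡ α
    *-identityˡ ⟨ x , y ⟩ = cong₂ ⟨_,_⟩ (on-re x y) (on-im A x y)
      where
      on-re : ∀ x y → 1ℤ ℤ.* x ℤ.- 0ℤ ℤ.* y ≡ x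
      on-re = solve-∀
      on-im : ∀ k x y → 1ℤ ℤ.* y ℤ.+ 0ℤ ℤ.* x ℤ.+ k ℤ.* 0ℤ ℤ.* y ≡ y
      on-im = solve-∀
    *-identityʳ : ∀ α → α * 𝟙 ≡ α
    *-identityʳ α = trans (*-comm α 𝟙) (*-identityˡ α)
    distribʳ : ∀ α β γ → (β + γ) * α ≡ β * α + γ * α
    distribʳ ⟨ s , t ⟩ ⟨ x , y ⟩ ⟨ u , v ⟩ = cong₂ ⟨_,_⟩ (on-re x y u v s t) (on-im A x y u v s t)
      where
      on-re : ∀ x y u v s t → (x ℤ.+ u) ℤ.* s ℤ.- (y ℤ.+ v) ℤ.* t ≡ (x ℤ.* s ℤ.- y ℤ.* t) ℤ.+ (u ℤ.* s ℤ.- v ℤ.* t)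
      on-re = solve-∀
      on-im : ∀ k x y u v s t →
        (x ℤ.+ u) ℤ.* t ℤ.+ (y ℤ.+ v) ℤ.* s ℤ.+ k ℤ.* (y ℤ.+ v) ℤ.* t
          ≡ (x ℤ.* t ℤ.+ y ℤ.* s ℤ.+ k ℤ.* y ℤ.* t) ℤ.+ (u ℤ.* t ℤ.+ v ℤ.* s ℤ.+ k ℤ.* v ℤ.* t)
      on-im = solve-∀
    distribˡ : ∀ α β γ → α * (β + γ) ≡ α * β + α * γ
    distribˡ α β γ = trans (*-comm α (β + γ)) (trans (distribʳ α β γ) (cong₂ _+_ (*-comm β α) (*-comm γ α)))

module ThetaExpansions (a : ℕ) (3≤a : 3 ℕ.≤ a) where
  open Q a hiding (_≤_)
  open ZθRing a
  private
    module Ring = IsCommutativeRing Zθ-isCommutativeRing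
    module ℤO = IntegerOrder

    1≤a : 1 ℕ.≤ a
    1≤a = ℕP.≤-trans (s≤s z≤n) 3≤a

    2≤a : 2 ℕ.≤ a
    2≤a = ℕP.≤-trans (s≤s (s≤s z≤n)) 3≤a

    0≤A-1 : 0ℤ ℤO.≤ A ℤ.- 1ℤ
    0≤A-1 = ℤO.x≤y⇒0≤y-x (ℤO.fromℤ≤ (ℤ.+≤+ 1≤a))

    [A-1]²<D : (A ℤ.- 1ℤ) ℤ.* (A ℤ.- 1ℤ) ℤ.< D
    [A-1]²<D = ℤO.0<y-x⇒x<y (subst (0ℤ ℤ.<_) (gap A)
                 (ℤO.0<+ (ℤO.0<+ ℤO.0<1 0≤A-3) 0≤A-3))
      where
      0≤A-3 : 0ℤ ℤO.≤ A ℤ.- + 3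
      0≤A-3 = ℤO.x≤y⇒0≤y-x (ℤO.fromℤ≤ (ℤ.+≤+ 3≤a))
      gap : ∀ k → 1ℤ ℤ.+ (k ℤ.- + 3) ℤ.+ (k ℤ.- + 3) ≡ (k ℤ.* k ℤ.- + 4) ℤ.- (k ℤ.- 1ℤ) ℤ.* (k ℤ.- 1ℤ)
      gap = solve-∀

    D<A² : D ℤ.< (A ℤ.- 1ℤ ℤ.+ 1ℤ) ℤ.* (A ℤ.- 1ℤ ℤ.+ 1ℤ)
    D<A² = ℤO.0<y-x⇒x<y (subst (0ℤ ℤ.<_) (gap A) (ℤ.+<+ (s≤s z≤n)))
      where
      gap : ∀ k → + 4 ≡ (k ℤ.- 1ℤ ℤ.+ 1ℤ) ℤ.* (k ℤ.- 1ℤ ℤ.+ 1ℤ) ℤ.- (k ℤ.* k ℤ.- + 4)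
      gap = solve-∀

    0<D : 0ℤ ℤ.< D
    0<D = ℤO.≤-<-trans (ℤO.0≤x*x (A ℤ.- 1ℤ)) [A-1]²<D

  open QuadraticSurd D 0<D (ℤO.√-irrational 0≤A-1 [A-1]²<D D<A²)

  -- 2(x + yθ) = (2x + ay) + y√D, as θ = (a + √D)/2.
  twice : Zθ → Surd
  twice ⟨ x , y ⟩ = ⟪ + 2 ℤ.* x ℤ.+ A ℤ.* y , y ⟫

  twice-+ : ∀ α β → twice (α + β) ≡ twice α ⊕ twice β
  twice-+ ⟨ x , y ⟩ ⟨ u , v ⟩ = cong₂ ⟪_,_⟫ (on-rat A x y u v) refl
    where
    on-rat : ∀ k x y u v → + 2 ℤ.* (x ℤ.+ u) ℤ.+ k ℤ.* (y ℤ.+ v) ≡ + 2 ℤ.* x ℤ.+ k ℤ.* y ℤ.+ (+ 2 ℤ.* u ℤ.+ k ℤ.* v)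
    on-rat = solve-∀

  twice-* : ∀ α β → twice (α * β) ⊗ ⟪ + 2 , 0ℤ ⟫ ≡ twice α ⊗ twice β
  twice-* ⟨ x , y ⟩ ⟨ u , v ⟩ = cong₂ ⟪_,_⟫ (on-rat A x y u v) (on-irr A x y u v)
    where
    on-rat : ∀ k x y u v →
      (+ 2 ℤ.* (x ℤ.* u ℤ.- y ℤ.* v) ℤ.+ k ℤ.* (x ℤ.* v ℤ.+ y ℤ.* u ℤ.+ k ℤ.* y ℤ.* v)) ℤ.* + 2
        ℤ.+ (x ℤ.* v ℤ.+ y ℤ.* u ℤ.+ k ℤ.* y ℤ.* v) ℤ.* 0ℤ ℤ.* (k ℤ.* k ℤ.- + 4)
      ≡ (+ 2 ℤ.* x ℤ.+ k ℤ.* y) ℤ.* (+ 2 ℤ.* u ℤ.+ k ℤ.* v) ℤ.+ y ℤ.* v ℤ.* (k ℤ.* k ℤ.- + 4)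
    on-rat = solve-∀
    on-irr : ∀ k x y u v →
      (+ 2 ℤ.* (x ℤ.* u ℤ.- y ℤ.* v) ℤ.+ k ℤ.* (x ℤ.* v ℤ.+ y ℤ.* u ℤ.+ k ℤ.* y ℤ.* v)) ℤ.* 0ℤ
        ℤ.+ (x ℤ.* v ℤ.+ y ℤ.* u ℤ.+ k ℤ.* y ℤ.* v) ℤ.* + 2
      ≡ (+ 2 ℤ.* x ℤ.+ k ℤ.* y) ℤ.* v ℤ.+ y ℤ.* (+ 2 ℤ.* u ℤ.+ k ℤ.* v)
    on-irr = solve-∀

  twice-neg : ∀ α → twice (- α) ≡ ⊖ twice α
  twice-neg ⟨ x , y ⟩ = cong₂ ⟪_,_⟫ (on-rat A x y) refl
    where
    on-rat : ∀ k x y → + 2 ℤ.* ℤ.- x ℤ.+ k ℤ.* ℤ.- y ≡ ℤ.- (+ 2 ℤ.* x ℤ.+ k ℤ.* y)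
    on-rat = solve-∀

  twice≡0 : ∀ {α} → twice α ≡ ⟪ 0ℤ , 0ℤ ⟫ → α ≡ 𝟘
  twice≡0 {⟨ x , y ⟩} twiceα≡0 = cong₂ ⟨_,_⟩ x≡0 y≡0
    where
    y≡0 : y ≡ 0ℤ
    y≡0 = cong (λ { ⟪ _ , q ⟫ → q }) twiceα≡0
    x≡0 : x ≡ 0ℤ
    x≡0 = ℤP.*-cancelˡ-≡ (+ 2) x 0ℤ (begin
      + 2 ℤ.* x              ≡⟨ ℤP.+-identityʳ (+ 2 ℤ.* x) ⟨
      + 2 ℤ.* x ℤ.+ 0ℤ       ≡⟨ cong (λ y → + 2 ℤ.* x ℤ.+ y) (trans (cong (A ℤ.*_) y≡0) (ℤP.*-zeroʳ A)) ⟨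
      + 2 ℤ.* x ℤ.+ A ℤ.* y  ≡⟨ cong (λ { ⟪ p , _ ⟫ → p }) twiceα≡0 ⟩
      0ℤ                     ∎)
      where open ≡-Reasoning

  x-𝟘≡x : ∀ α → α - 𝟘 ≡ α
  x-𝟘≡x ⟨ x , y ⟩ = cong₂ ⟨_,_⟩ (ℤP.+-identityʳ x) (ℤP.+-identityʳ y)

  private
    diff-trans : ∀ α β γ → (γ - β) + (β - α) ≡ γ - α
    diff-trans ⟨ x , y ⟩ ⟨ u , v ⟩ ⟨ s , t ⟩ = cong₂ ⟨_,_⟩ (on-ℤ x u s) (on-ℤ y v t)
      where
      on-ℤ : ∀ x u s → s ℤ.- u ℤ.+ (u ℤ.- x) ≡ s ℤ.- x
      on-ℤ = solve-∀

    diff-+ : ∀ α β γ → (β + γ) - (α + γ) ≡ β - α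
    diff-+ ⟨ x , y ⟩ ⟨ u , v ⟩ ⟨ s , t ⟩ = cong₂ ⟨_,_⟩ (on-ℤ x u s) (on-ℤ y v t)
      where
      on-ℤ : ∀ x u s → u ℤ.+ s ℤ.- (x ℤ.+ s) ≡ u ℤ.- x
      on-ℤ = solve-∀

    neg-diff : ∀ α β → - (β - α) ≡ α - β
    neg-diff ⟨ x , y ⟩ ⟨ u , v ⟩ = cong₂ ⟨_,_⟩ (on-ℤ x u) (on-ℤ y v)
      where
      on-ℤ : ∀ x u → ℤ.- (u ℤ.- x) ≡ x ℤ.- u
      on-ℤ = solve-∀

    diff≡0 : ∀ α β → β - α ≡ 𝟘 → α ≡ β
    diff≡0 ⟨ x , y ⟩ ⟨ u , v ⟩ eq =
      sym (cong₂ ⟨_,_⟩ (ℤP.i-j≡0⇒i≡j u x (cong re eq)) (ℤP.i-j≡0⇒i≡j v y (cong im eq)))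

    twice-𝟘 : twice 𝟘 ≡ ⟪ 0ℤ , 0ℤ ⟫
    twice-𝟘 = cong (λ z → ⟪ z , 0ℤ ⟫) (trans (ℤP.+-identityˡ (A ℤ.* 0ℤ)) (ℤP.*-zeroʳ A))

    positive-2 : Positive ⟪ + 2 , 0ℤ ⟫
    positive-2 = rational-dominant (ℤ.+<+ (s≤s z≤n)) (subst (ℤ._< + 4) (sym (ℤP.*-zeroˡ D)) (ℤ.+<+ (s≤s z≤n)))

  infix 4 _<_
  data _<_ (α β : Zθ) : Set where
    mk< : Positive (twice (β - α)) → α < β

  Zθ-orderedCommutativeRing : OrderedCommutativeRing
  Zθ-orderedCommutativeRing = record
    { isCommutativeRing    = Zθ-isCommutativeRing
    ; <-isStrictTotalOrder = record
      { isStrictPartialOrder = record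
        { isEquivalence = isEquivalence
        ; irrefl        = <-irrefl
        ; trans         = <-trans
        ; <-resp-≈      = resp₂ _<_ }
      ; compare = compare }
    ; +-monoˡ-<            = +-monoˡ-<
    ; 0<1                  = mk< (subst Positive (cong (λ z → ⟪ + 2 ℤ.+ z , 0ℤ ⟫) (sym (ℤP.*-zeroʳ A))) positive-2)
    ; 0<*                  = 0<*
    }
    where
    <-irrefl : ∀ {α β} → α ≡ β → ¬ (α < β)
    <-irrefl {α} refl (mk< α<α) = ¬positive-0 (subst Positive (trans (cong twice (Ring.-‿inverseʳ α)) twice-𝟘) α<α)

    <-trans : ∀ {α β γ} → α < β → β < γ → α < γ
    <-trans {α} {β} {γ} (mk< α<β) (mk< β<γ) =
      mk< (subst Positive (trans (sym (twice-+ (γ - β) (β - α))) (cong twice (diff-trans α β γ))) (⊕-positive β<γ α<β))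

    <-asym : ∀ {α β} → α < β → ¬ (β < α)
    <-asym α<β β<α = <-irrefl refl (<-trans α<β β<α)

    compare : Trichotomous _≡_ _<_
    compare α β = from-sum (sum (positive-trichotomy (twice (β - α))))
      where
      sum : twice (β - α) ≡ ⟪ 0ℤ , 0ℤ ⟫ ⊎ Positive (twice (β - α)) ⊎ Positive (⊖ twice (β - α)) →
            α ≡ β ⊎ α < β ⊎ β < α
      sum (inj₁ twice[β-α]≡0) = inj₁ (diff≡0 α β (twice≡0 twice[β-α]≡0))
      sum (inj₂ (inj₁ α<β)) = inj₂ (inj₁ (mk< α<β))
      sum (inj₂ (inj₂ β<α)) =
        inj₂ (inj₂ (mk< (subst Positive (trans (sym (twice-neg (β - α))) (cong twice (neg-diff α β))) β<α)))
      from-sum : α ≡ β ⊎ α < β ⊎ β < α → Tri (α < β) (α ≡ β) (β < α)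
      from-sum (inj₁ α≡β) = tri≈ (<-irrefl α≡β) α≡β (<-irrefl (sym α≡β))
      from-sum (inj₂ (inj₁ α<β)) = tri< α<β (λ α≡β → <-irrefl α≡β α<β) (<-asym α<β)
      from-sum (inj₂ (inj₂ β<α)) = tri> (<-asym β<α) (λ α≡β → <-irrefl (sym α≡β) β<α) β<α

    +-monoˡ-< : ∀ γ {α β} → α < β → α + γ < β + γ
    +-monoˡ-< γ {α} {β} (mk< α<β) = mk< (subst Positive (cong twice (sym (diff-+ α β γ))) α<β)

    0<* : ∀ {α β} → 𝟘 < α → 𝟘 < β → 𝟘 < α * β
    0<* {α} {β} (mk< 0<α) (mk< 0<β) = mk< (subst Positive (cong twice (sym (x-𝟘≡x (α * β))))
      (⊗-cancelʳ-positive (subst Positive (sym (twice-* α β))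
        (⊗-positive (subst Positive (cong twice (x-𝟘≡x α)) 0<α) (subst Positive (cong twice (x-𝟘≡x β)) 0<β)))
        positive-2))

  open OrderedCommutativeRingProperties Zθ-orderedCommutativeRing
    hiding (Carrier; _+_; _*_; -_; _-_; 0#; 1#; _<_)

  -- Positivity and order as defined by isPos

  Pos⇒0< : ∀ {α} → Pos α → 𝟘 < α
  Pos⇒0< {α} Posα = mk< (subst (Positive ∘ twice) (sym (x-𝟘≡x α)) (positive?-sound (twice α) Posα))

  0<⇒Pos : ∀ {α} → 𝟘 < α → Pos α
  0<⇒Pos {α} (mk< 0<α) = positive?-complete (subst (Positive ∘ twice) (x-𝟘≡x α) 0<α)

  Neg⇒<0 : ∀ {α} → Neg α → α < 𝟘
  Neg⇒<0 = 0<-x⇒x<0 ∘ Pos⇒0<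

  <0⇒Neg : ∀ {α} → α < 𝟘 → Neg α
  <0⇒Neg = 0<⇒Pos ∘ x<0⇒0<-x

  private
    isZero-sound : ∀ γ → T (isZero γ) → γ ≡ 𝟘
    isZero-sound ⟨ x , y ⟩ h with Equivalence.to T-∧ h
    ... | x=0 , y=0 = cong₂ ⟨_,_⟩ (=ᶻ-sound x=0) (=ᶻ-sound y=0)
      where
      =ᶻ-sound : ∀ {i j} → T (i =ᶻ j) → i ≡ j
      =ᶻ-sound i=j with Equivalence.to T-∧ i=j
      ... | i≤j , j≤i = ℤP.≤-antisym (ℤP.≤ᵇ⇒≤ i≤j) (ℤP.≤ᵇ⇒≤ j≤i)

  ≤⇒≤ᵇ : ∀ {α β} → α ≤ β → T (α ≤ᵇ β)
  ≤⇒≤ᵇ {α} {β} (inj₁ (mk< α<β)) = Equivalence.from T-∨ (inj₂ (positive?-complete α<β))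
  ≤⇒≤ᵇ {α} (inj₂ refl) = subst (λ γ → T (isZero γ ∨ isPos γ)) (sym (-‿inverseʳ α)) tt

  ≤ᵇ⇒≤ : ∀ {α β} → T (α ≤ᵇ β) → α ≤ β
  ≤ᵇ⇒≤ {α} {β} h with Equivalence.to T-∨ h
  ... | inj₁ β-α=0 = inj₂ (sym (x∙y⁻¹≈ε⇒x≈y β α (isZero-sound (β - α) β-α=0)))
  ... | inj₂ β-α>0 = inj₁ (mk< (positive?-sound (twice (β - α)) β-α>0))

  private
    if-cases : ∀ {A : Set} b (x y : A) → (T b × (if b then x else y) ≡ x) ⊎ (¬ T b × (if b then x else y) ≡ y)
    if-cases true  x y = inj₁ (tt , refl)
    if-cases false x y = inj₂ ((λ ()) , refl)

  max-sel : ∀ α β → max α β ≡ α ⊎ max α β ≡ β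
  max-sel α β with if-cases (α ≤ᵇ β) β α
  ... | inj₁ (_ , max≡β) = inj₂ max≡β
  ... | inj₂ (_ , max≡α) = inj₁ max≡α

  x≤max : ∀ α β → α ≤ max α β
  x≤max α β with if-cases (α ≤ᵇ β) β α
  ... | inj₁ (α≤β , max≡β) = subst (α ≤_) (sym max≡β) (≤ᵇ⇒≤ α≤β)
  ... | inj₂ (_ , max≡α) = inj₂ (sym max≡α)

  y≤max : ∀ α β → β ≤ max α β
  y≤max α β with if-cases (α ≤ᵇ β) β α
  ... | inj₁ (_ , max≡β) = inj₂ (sym max≡β)
  ... | inj₂ (α≰β , max≡α) = subst (β ≤_) (sym max≡α) (<⇒≤ (≰⇒> (α≰β ∘ ≤⇒≤ᵇ)))

  0≤fromℕ : ∀ n → 𝟘 ≤ fromℕ n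
  0≤fromℕ zero = ≤-refl
  0≤fromℕ (suc n) = inj₁ (0<+ 0<1 (0≤fromℕ n))

  fromℕ-mono-≤ : ∀ {m n} → m ℕ.≤ n → fromℕ m ≤ fromℕ n
  fromℕ-mono-≤ {m} {n} m≤n = subst (λ k → fromℕ m ≤ fromℕ k) (ℕP.m+[n∸m]≡n m≤n)
    (subst (_≤ fromℕ m + fromℕ (n ℕ.∸ m)) (+-identityʳ (fromℕ m)) (+-monoʳ-≤ (fromℕ m) (0≤fromℕ (n ℕ.∸ m))))

  -- θ and conjugation

  θ*θ⁻¹ : θ * θ⁻¹ ≡ 𝟙
  θ*θ⁻¹ = cong₂ ⟨_,_⟩ (on-re A) (on-im A)
    where
    on-re : ∀ k → 0ℤ ℤ.* k ℤ.- 1ℤ ℤ.* ℤ.- 1ℤ ≡ 1ℤ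
    on-re = solve-∀
    on-im : ∀ k → 0ℤ ℤ.* ℤ.- 1ℤ ℤ.+ 1ℤ ℤ.* k ℤ.+ k ℤ.* 1ℤ ℤ.* ℤ.- 1ℤ ≡ 0ℤ
    on-im = solve-∀

  1<θ : 𝟙 < θ
  1<θ = mk< (positive-nonneg-parts 0≤A-2 (ℤ.+<+ (s≤s z≤n)))
    where
    0≤A-2 : 0ℤ ℤO.≤ ℤ.-[1+ 1 ] ℤ.+ A ℤ.* 1ℤ
    0≤A-2 = subst (0ℤ ℤO.≤_) (eq A) (ℤO.x≤y⇒0≤y-x (ℤO.fromℤ≤ (ℤ.+≤+ 2≤a)))
      where
      eq : ∀ k → k ℤ.- + 2 ≡ ℤ.-[1+ 1 ] ℤ.+ k ℤ.* 1ℤ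
      eq = solve-∀

  0<θ : 𝟘 < θ
  0<θ = <-trans 0<1 1<θ

  0<Tθ : 𝟘 < Tθ
  0<Tθ = x<y⇒0<y-x 1<θ

  0<θ⁻¹ : 𝟘 < θ⁻¹
  0<θ⁻¹ = *-cancelˡ-< (<⇒≤ 0<θ) (subst₂ _<_ (sym (zeroʳ θ)) (sym θ*θ⁻¹) 0<1)

  θ⁻¹<1 : θ⁻¹ < 𝟙
  θ⁻¹<1 = subst₂ _<_ (*-identityʳ θ⁻¹) (trans (*-comm θ⁻¹ θ) θ*θ⁻¹) (*-monoʳ-< 0<θ⁻¹ 1<θ)

  a-1<θ : fromℕ (a ℕ.∸ 1) < θ
  a-1<θ = +-cancelʳ-< 𝟙 (subst (_< θ + 𝟙) a-1+1≡θ+θ⁻¹ (+-monoʳ-< θ θ⁻¹<1))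
    where
    -- θ + θ⁻¹ reduces to fromℕ a.
    a-1+1≡θ+θ⁻¹ : θ + θ⁻¹ ≡ fromℕ (a ℕ.∸ 1) + 𝟙
    a-1+1≡θ+θ⁻¹ = cong fromℕ (sym (ℕP.m∸n+n≡m 1≤a))

  2<θ : 𝟙 + 𝟙 < θ
  2<θ = ≤-<-trans (fromℕ-mono-≤ (ℕP.∸-monoˡ-≤ 1 3≤a)) a-1<θ

  2<[θ-1]θ : 𝟙 + 𝟙 < (θ - 𝟙) * θ
  2<[θ-1]θ = subst (_< (θ - 𝟙) * θ) (*-identityˡ (𝟙 + 𝟙))
    (*-mono-< (<⇒≤ 0<1) 1<θ-1 (<⇒≤ (0<+ 0<1 (<⇒≤ 0<1))) 2<θ)
    where
    1<θ-1 : 𝟙 < θ - 𝟙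
    1<θ-1 = +-cancelʳ-< 𝟙 (subst (𝟙 + 𝟙 <_) (sym (x-y+y≡x θ 𝟙)) 2<θ)

  conj-+ : ∀ α β → conj (α + β) ≡ conj α + conj β
  conj-+ ⟨ x , y ⟩ ⟨ u , v ⟩ = cong₂ ⟨_,_⟩ (on-re A x y u v) (ℤP.neg-distrib-+ y v)
    where
    on-re : ∀ k x y u v → x ℤ.+ u ℤ.+ k ℤ.* (y ℤ.+ v) ≡ x ℤ.+ k ℤ.* y ℤ.+ (u ℤ.+ k ℤ.* v)
    on-re = solve-∀

  conj-* : ∀ α β → conj (α * β) ≡ conj α * conj β
  conj-* ⟨ x , y ⟩ ⟨ u , v ⟩ = cong₂ ⟨_,_⟩ (on-re A x y u v) (on-im A x y u v)
    where
    on-re : ∀ k x y u v → x ℤ.* u ℤ.- y ℤ.* v ℤ.+ k ℤ.* (x ℤ.* v ℤ.+ y ℤ.* u ℤ.+ k ℤ.* y ℤ.* v)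
                        ≡ (x ℤ.+ k ℤ.* y) ℤ.* (u ℤ.+ k ℤ.* v) ℤ.- ℤ.- y ℤ.* ℤ.- v
    on-re = solve-∀
    on-im : ∀ k x y u v → ℤ.- (x ℤ.* v ℤ.+ y ℤ.* u ℤ.+ k ℤ.* y ℤ.* v)
                        ≡ (x ℤ.+ k ℤ.* y) ℤ.* ℤ.- v ℤ.+ ℤ.- y ℤ.* (u ℤ.+ k ℤ.* v) ℤ.+ k ℤ.* ℤ.- y ℤ.* ℤ.- v
    on-im = solve-∀

  conj-neg : ∀ α → conj (- α) ≡ - conj α
  conj-neg ⟨ x , y ⟩ = cong₂ ⟨_,_⟩ (on-re A x y) refl
    where
    on-re : ∀ k x y → ℤ.- x ℤ.+ k ℤ.* ℤ.- y ≡ ℤ.- (x ℤ.+ k ℤ.* y)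
    on-re = solve-∀

  ∣conj-neg∣ : ∀ x → ∣ conj (- x) ∣ ≡ ∣ conj x ∣
  ∣conj-neg∣ x = trans (cong ∣_∣ (conj-neg x)) (∣-x∣≡∣x∣ (conj x))

  conj-conj : ∀ α → conj (conj α) ≡ α
  conj-conj ⟨ x , y ⟩ = cong₂ ⟨_,_⟩ (on-re A x y) (ℤP.neg-involutive y)
    where
    on-re : ∀ k x y → x ℤ.+ k ℤ.* y ℤ.+ k ℤ.* ℤ.- y ≡ x
    on-re = solve-∀

  conj-fromℕ : ∀ n → conj (fromℕ n) ≡ fromℕ n
  conj-fromℕ n = cong (λ z → ⟨ z , 0ℤ ⟩) (trans (cong (ℤ._+_ (+ n)) (ℤP.*-zeroʳ A)) (ℤP.+-identityʳ (+ n)))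

  conj-θ : conj θ ≡ θ⁻¹
  conj-θ = cong (λ z → ⟨ z , ℤ.- 1ℤ ⟩) (trans (ℤP.+-identityˡ (A ℤ.* 1ℤ)) (ℤP.*-identityʳ A))

  conj-θ⁻¹ : conj θ⁻¹ ≡ θ
  conj-θ⁻¹ = cong (λ z → ⟨ z , 1ℤ ⟩) (on-re A)
    where
    on-re : ∀ k → k ℤ.+ k ℤ.* ℤ.- 1ℤ ≡ 0ℤ
    on-re = solve-∀

  conj-powℕ : ∀ β n → conj (powℕ β n) ≡ powℕ (conj β) n
  conj-powℕ β zero = conj-fromℕ 1
  conj-powℕ β (suc n) = trans (conj-* β (powℕ β n)) (cong (conj β *_) (conj-powℕ β n))

  conj-pow : ∀ m → conj (pow m) ≡ pow (ℤ.- m)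
  conj-pow (+ zero) = conj-fromℕ 1
  conj-pow (+ suc n) = trans (conj-powℕ θ (suc n)) (cong (λ β → powℕ β (suc n)) conj-θ)
  conj-pow -[1+ n ] = trans (conj-powℕ θ⁻¹ (suc n)) (cong (λ β → powℕ β (suc n)) conj-θ⁻¹)

  -- Powers of θ

  0<powℕ : ∀ {β} → 𝟘 < β → ∀ n → 𝟘 < powℕ β n
  0<powℕ 0<β zero = 0<1
  0<powℕ 0<β (suc n) = 0<* 0<β (0<powℕ 0<β n)

  0<pow : ∀ k → 𝟘 < pow k
  0<pow (+ n) = 0<powℕ 0<θ n
  0<pow -[1+ n ] = 0<powℕ 0<θ⁻¹ (suc n)

  pow-suc : ∀ k → pow (ℤ.suc k) ≡ θ * pow k
  pow-suc (+ n) = refl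
  pow-suc -[1+ zero ] = sym (trans (cong (θ *_) (*-identityʳ θ⁻¹)) θ*θ⁻¹)
  pow-suc -[1+ suc n ] =
    sym (trans (sym (*-assoc θ θ⁻¹ (powℕ θ⁻¹ (suc n)))) (trans (cong (_* powℕ θ⁻¹ (suc n)) θ*θ⁻¹) (*-identityˡ _)))

  powℕ-monoʳ-≤ : ∀ {β} → 𝟙 ≤ β → ∀ {m n} → m ℕ.≤ n → powℕ β m ≤ powℕ β n
  powℕ-monoʳ-≤ {β} 1≤β {n = n} z≤n = 1≤powℕ n
    where
    1≤powℕ : ∀ n → 𝟙 ≤ powℕ β n
    1≤powℕ zero = ≤-refl
    1≤powℕ (suc n) = subst (_≤ powℕ β (suc n)) (*-identityʳ 𝟙) (*-mono-≤ (<⇒≤ 0<1) 1≤β (<⇒≤ 0<1) (1≤powℕ n))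
  powℕ-monoʳ-≤ 1≤β (s≤s m≤n) = *-monoʳ-≤ (≤-trans (<⇒≤ 0<1) 1≤β) (powℕ-monoʳ-≤ 1≤β m≤n)

  powℕ-antiʳ-≤ : ∀ {β} → 𝟘 ≤ β → β ≤ 𝟙 → ∀ {m n} → m ℕ.≤ n → powℕ β n ≤ powℕ β m
  powℕ-antiʳ-≤ {β} 0≤β β≤1 {n = n} z≤n = powℕ≤1 n
    where
    powℕ≤1 : ∀ n → powℕ β n ≤ 𝟙
    powℕ≤1 zero = ≤-refl
    powℕ≤1 (suc n) = subst (powℕ β (suc n) ≤_) (*-identityʳ 𝟙) (*-mono-≤ 0≤β β≤1 (0≤powℕ n) (powℕ≤1 n))
      where
      0≤powℕ : ∀ n → 𝟘 ≤ powℕ β n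
      0≤powℕ zero = <⇒≤ 0<1
      0≤powℕ (suc n) = 0≤* 0≤β (0≤powℕ n)
  powℕ-antiʳ-≤ 0≤β β≤1 (s≤s m≤n) = *-monoʳ-≤ 0≤β (powℕ-antiʳ-≤ 0≤β β≤1 m≤n)

  θ²*x≡θ*[θ*x] : ∀ x → powℕ θ 2 * x ≡ θ * (θ * x)
  θ²*x≡θ*[θ*x] x = trans (*-assoc θ (θ * 𝟙) x) (cong (θ *_) (trans (*-assoc θ 𝟙 x) (cong (θ *_) (*-identityˡ x))))

  1≤θ⁴ : 𝟙 ≤ powℕ θ 4
  1≤θ⁴ = powℕ-monoʳ-≤ (<⇒≤ 1<θ) {0} {4} z≤n

  pow-mono-≤ : ∀ {k j} → k ℤ.≤ j → pow k ≤ pow j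
  pow-mono-≤ (ℤ.-≤- n≤m) = powℕ-antiʳ-≤ (<⇒≤ 0<θ⁻¹) (<⇒≤ θ⁻¹<1) (s≤s n≤m)
  pow-mono-≤ { -[1+ m ]} {+ n} ℤ.-≤+ =
    ≤-trans (powℕ-antiʳ-≤ (<⇒≤ 0<θ⁻¹) (<⇒≤ θ⁻¹<1) {0} {suc m} z≤n) (powℕ-monoʳ-≤ (<⇒≤ 1<θ) {0} {n} z≤n)
  pow-mono-≤ (ℤ.+≤+ m≤n) = powℕ-monoʳ-≤ (<⇒≤ 1<θ) m≤n

  pow-gap : ∀ {k j} → pow k < θ * pow j → pow k ≤ pow j
  pow-gap {k} {j} θᵏ<θʲ⁺¹ with k ℤP.≤? j
  ... | yes k≤j = pow-mono-≤ k≤j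
  ... | no k≰j =
    ⊥-elim (≤⇒≯ (subst (_≤ pow k) (pow-suc j) (pow-mono-≤ (ℤP.i<j⇒suc[i]≤j (ℤP.≰⇒> k≰j)))) θᵏ<θʲ⁺¹)

  PowerOfθOrZero : Zθ → Set
  PowerOfθOrZero x = x ≡ 𝟘 ⊎ ∃ λ k → x ≡ pow k

  PowerOfθOrZero⇒0≤ : ∀ {x} → PowerOfθOrZero x → 𝟘 ≤ x
  PowerOfθOrZero⇒0≤ (inj₁ refl) = ≤-refl
  PowerOfθOrZero⇒0≤ (inj₂ (k , refl)) = <⇒≤ (0<pow k)

  θ*-PowerOfθOrZero : ∀ {x} → PowerOfθOrZero x → PowerOfθOrZero (θ * x)
  θ*-PowerOfθOrZero (inj₁ refl) = inj₁ (zeroʳ θ)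
  θ*-PowerOfθOrZero (inj₂ (k , refl)) = inj₂ (ℤ.suc k , sym (pow-suc k))

  -- c·n ≤ 2m < cθ·m gives n < θm.
  power-gap : ∀ {n m c} → PowerOfθOrZero n → PowerOfθOrZero m →
              𝟘 < c → c * n ≤ m + m → 𝟙 + 𝟙 < c * θ → n ≤ m
  power-gap {n} {c = c} _ (inj₁ refl) 0<c cn≤0 _ =
    *-cancelˡ-≤ 0<c (subst (c * n ≤_) (sym (zeroʳ c)) cn≤0)
  power-gap (inj₁ refl) m-power _ _ _ = PowerOfθOrZero⇒0≤ m-power
  power-gap {c = c} (inj₂ (k , refl)) (inj₂ (j , refl)) 0<c cθᵏ≤2θʲ 2<cθ =
    pow-gap {k} {j} (*-cancelˡ-< (<⇒≤ 0<c) (begin-strict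
    c * pow k            ≤⟨ cθᵏ≤2θʲ ⟩
    pow j + pow j        ≡⟨ x+x≡2x (pow j) ⟩
    (𝟙 + 𝟙) * pow j      <⟨ *-monoˡ-< (0<pow j) 2<cθ ⟩
    c * θ * pow j        ≡⟨ *-assoc c θ (pow j) ⟩
    c * (θ * pow j)      ∎))
    where
    open ≤-Reasoning
    x+x≡2x : ∀ x → x + x ≡ (𝟙 + 𝟙) * x
    x+x≡2x x = sym (trans (distribʳ x 𝟙 𝟙) (cong₂ _+_ (*-identityˡ x) (*-identityˡ x)))

  pow-band-unique : ∀ {k j c} → pow k ≤ c → c < θ * pow k → pow j ≤ c → c < θ * pow j → pow k ≡ pow j
  pow-band-unique {k} {j} θᵏ≤c c<θᵏ⁺¹ θʲ≤c c<θʲ⁺¹ =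
    ≤-antisym (pow-gap {k} {j} (≤-<-trans θᵏ≤c c<θʲ⁺¹)) (pow-gap {j} {k} (≤-<-trans θʲ≤c c<θᵏ⁺¹))

  -- Conjugates of greedy expansions

  conj-horner-∷ : ∀ b bs → conj (horner (b ∷ bs)) ≡ fromℕ b + θ⁻¹ * conj (horner bs)
  conj-horner-∷ b bs = trans (conj-+ (fromℕ b) (θ * horner bs))
    (cong₂ _+_ (conj-fromℕ b) (trans (conj-* θ (horner bs)) (cong (_* conj (horner bs)) conj-θ)))

  0≤conj-horner : ∀ ds → 𝟘 ≤ conj (horner ds)
  0≤conj-horner [] = inj₂ (sym (conj-fromℕ 0))
  0≤conj-horner (b ∷ bs) = subst (𝟘 ≤_) (sym (conj-horner-∷ b bs))
    (0≤+ (0≤fromℕ b) (0≤* (<⇒≤ 0<θ⁻¹) (0≤conj-horner bs)))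

  1≤conj-horner : ∀ {b} bs → b ≢ 0 → 𝟙 ≤ conj (horner (b ∷ bs))
  1≤conj-horner {zero} bs b≢0 = ⊥-elim (b≢0 refl)
  1≤conj-horner {suc b} bs _ = subst (𝟙 ≤_) (sym (conj-horner-∷ (suc b) bs))
    (subst (_≤ fromℕ (suc b) + θ⁻¹ * conj (horner bs)) (+-identityʳ 𝟙)
      (+-mono-≤ (fromℕ-mono-≤ (s≤s z≤n)) (0≤* (<⇒≤ 0<θ⁻¹) (0≤conj-horner bs))))

  private
    a≡2+[a∸2] : a ≡ suc (suc (a ℕ.∸ 2))
    a≡2+[a∸2] = sym (ℕP.m+[n∸m]≡n 2≤a)

    a∸1≡1+[a∸2] : a ℕ.∸ 1 ≡ suc (a ℕ.∸ 2)
    a∸1≡1+[a∸2] = cong (ℕ._∸ 1) a≡2+[a∸2]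

    fromℕ[a∸1] : fromℕ (a ℕ.∸ 1) ≡ ⟨ A ℤ.- 1ℤ , 0ℤ ⟩
    fromℕ[a∸1] = cong (λ z → ⟨ z , 0ℤ ⟩) (sym (ℤP.⊖-≥ 1≤a))

    fromℕ[a∸2] : fromℕ (a ℕ.∸ 2) ≡ ⟨ A ℤ.- + 2 , 0ℤ ⟩
    fromℕ[a∸2] = cong (λ z → ⟨ z , 0ℤ ⟩) (sym (ℤP.⊖-≥ 2≤a))

  a-1+θ⁻¹[θ-1]≡θ : fromℕ (a ℕ.∸ 1) + θ⁻¹ * (θ - 𝟙) ≡ θ
  a-1+θ⁻¹[θ-1]≡θ = trans (cong (_+ θ⁻¹ * (θ - 𝟙)) fromℕ[a∸1]) (cong₂ ⟨_,_⟩ (on-re A) (on-im A))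
    where
    on-re : ∀ k → k ℤ.- 1ℤ ℤ.+ (k ℤ.* ℤ.- 1ℤ ℤ.- ℤ.- 1ℤ ℤ.* 1ℤ) ≡ 0ℤ
    on-re = solve-∀
    on-im : ∀ k → 0ℤ ℤ.+ (k ℤ.* 1ℤ ℤ.+ ℤ.- 1ℤ ℤ.* ℤ.- 1ℤ ℤ.+ k ℤ.* ℤ.- 1ℤ ℤ.* 1ℤ) ≡ 1ℤ
    on-im = solve-∀

  a-2+θ⁻¹[θ-1]≡θ-1 : fromℕ (a ℕ.∸ 2) + θ⁻¹ * (θ - 𝟙) ≡ θ - 𝟙
  a-2+θ⁻¹[θ-1]≡θ-1 = trans (cong (_+ θ⁻¹ * (θ - 𝟙)) fromℕ[a∸2]) (cong₂ ⟨_,_⟩ (on-re A) (on-im A))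
    where
    on-re : ∀ k → k ℤ.- + 2 ℤ.+ (k ℤ.* ℤ.- 1ℤ ℤ.- ℤ.- 1ℤ ℤ.* 1ℤ) ≡ ℤ.- 1ℤ
    on-re = solve-∀
    on-im : ∀ k → 0ℤ ℤ.+ (k ℤ.* 1ℤ ℤ.+ ℤ.- 1ℤ ℤ.* ℤ.- 1ℤ ℤ.+ k ℤ.* ℤ.- 1ℤ ℤ.* 1ℤ) ≡ 1ℤ
    on-im = solve-∀

  a-2<θ-1 : fromℕ (a ℕ.∸ 2) < θ - 𝟙
  a-2<θ-1 = +-cancelʳ-< 𝟙 (subst₂ _<_ a-1≡a-2+1 (sym (x-y+y≡x θ 𝟙)) a-1<θ)
    where
    a-1≡a-2+1 : fromℕ (a ℕ.∸ 1) ≡ fromℕ (a ℕ.∸ 2) + 𝟙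
    a-1≡a-2+1 = trans (cong fromℕ a∸1≡1+[a∸2]) (+-comm 𝟙 (fromℕ (a ℕ.∸ 2)))

  -- (a - 1) ∷ ds starts with a forbidden word.
  CompletesForbidden : List ℕ → Set
  CompletesForbidden ds = ∃ λ j → ∃ λ suf → ds ≡ replicate j (a ℕ.∸ 2) ++ (a ℕ.∸ 1) ∷ suf

  private
    noForbidden-∷ : ∀ {d ds} → NoForbidden (d ∷ ds) → NoForbidden ds
    noForbidden-∷ {d} nf (pre , suf , j , ds≡) = nf (d ∷ pre , suf , j , cong (d ∷_) ds≡)

    noForbidden-a-1∷ : ∀ {ds} → NoForbidden ((a ℕ.∸ 1) ∷ ds) → ¬ CompletesForbidden ds
    noForbidden-a-1∷ nf (j , suf , ds≡) = nf ([] , suf , j , cong ((a ℕ.∸ 1) ∷_)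
      (trans ds≡ (sym (List.++-assoc (replicate j (a ℕ.∸ 2)) ((a ℕ.∸ 1) ∷ []) suf))))

    ¬completes-a-2∷ : ∀ {ds} → ¬ CompletesForbidden ((a ℕ.∸ 2) ∷ ds) → ¬ CompletesForbidden ds
    ¬completes-a-2∷ ¬c (j , suf , ds≡) = ¬c (suc j , suf , cong ((a ℕ.∸ 2) ∷_) ds≡)

    digit-cases : ∀ {d} → d ℕ.< a → d ≡ a ℕ.∸ 1 ⊎ d ≡ a ℕ.∸ 2 ⊎ d ℕ.< a ℕ.∸ 2
    digit-cases {d} d<a with ℕP.m≤n⇒m<n∨m≡n (ℕP.≤-pred (subst (d ℕ.<_) a≡2+[a∸2] d<a))
    ... | inj₂ d≡1+[a∸2] = inj₁ (trans d≡1+[a∸2] (sym a∸1≡1+[a∸2]))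
    ... | inj₁ d<1+[a∸2] = inj₂ (swap (ℕP.m≤n⇒m<n∨m≡n (ℕP.≤-pred d<1+[a∸2])))

    completes-a-1∷ : ∀ ds → CompletesForbidden ((a ℕ.∸ 1) ∷ ds)
    completes-a-1∷ ds = 0 , ds , refl

    conj-horner-∷-< : ∀ d bs {B} → conj (horner bs) < B → conj (horner (d ∷ bs)) < fromℕ d + θ⁻¹ * B
    conj-horner-∷-< d bs {B} S<B =
      subst (_< fromℕ d + θ⁻¹ * B) (sym (conj-horner-∷ d bs)) (+-monoʳ-< (fromℕ d) (*-monoʳ-< 0<θ⁻¹ S<B))

    conj-horner-∷-<-suc : ∀ d bs → conj (horner bs) < θ → conj (horner (d ∷ bs)) < fromℕ (suc d)
    conj-horner-∷-<-suc d bs S<θ = subst (conj (horner (d ∷ bs)) <_) d+1≡suc[d] (conj-horner-∷-< d bs S<θ)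
      where
      d+1≡suc[d] : fromℕ d + θ⁻¹ * θ ≡ fromℕ (suc d)
      d+1≡suc[d] = trans (cong (λ x → fromℕ d + x) (trans (*-comm θ⁻¹ θ) θ*θ⁻¹)) (+-comm (fromℕ d) 𝟙)

  -- conj (horner ds) = Σ dᵢθ⁻ⁱ; the bound θ - 1 on the tail is what makes a leading digit a - 1 fit.
  mutual
    conj-horner<θ : ∀ ds → All (ℕ._< a) ds → NoForbidden ds → conj (horner ds) < θ
    conj-horner<θ [] _ _ = subst (_< θ) (sym (conj-fromℕ 0)) 0<θ
    conj-horner<θ (d ∷ ds) (d<a ∷ ds<a) nf with digit-cases d<a
    ... | inj₁ refl = subst (conj (horner (d ∷ ds)) <_) a-1+θ⁻¹[θ-1]≡θ
      (conj-horner-∷-< d ds (conj-horner<θ-1 ds ds<a (noForbidden-∷ nf) (noForbidden-a-1∷ nf)))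
    ... | inj₂ (inj₁ refl) = <-trans (conj-horner-∷-<-suc d ds (conj-horner<θ ds ds<a (noForbidden-∷ nf)))
                                     (subst (λ n → fromℕ n < θ) a∸1≡1+[a∸2] a-1<θ)
    ... | inj₂ (inj₂ d<a∸2) = <-≤-trans (conj-horner-∷-<-suc d ds (conj-horner<θ ds ds<a (noForbidden-∷ nf)))
                                        (≤-trans (fromℕ-mono-≤ d<a∸2) (<⇒≤ (<-trans a-2<θ-1 (x-y<x 0<1))))

    conj-horner<θ-1 : ∀ ds → All (ℕ._< a) ds → NoForbidden ds → ¬ CompletesForbidden ds → conj (horner ds) < θ - 𝟙
    conj-horner<θ-1 [] _ _ _ = subst (_< θ - 𝟙) (sym (conj-fromℕ 0)) 0<Tθ
    conj-horner<θ-1 (d ∷ ds) (d<a ∷ ds<a) nf ¬c with digit-cases d<a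
    ... | inj₁ refl = ⊥-elim (¬c (completes-a-1∷ ds))
    ... | inj₂ (inj₁ refl) = subst (conj (horner (d ∷ ds)) <_) a-2+θ⁻¹[θ-1]≡θ-1
      (conj-horner-∷-< d ds (conj-horner<θ-1 ds ds<a (noForbidden-∷ nf) (¬completes-a-2∷ ¬c)))
    ... | inj₂ (inj₂ d<a∸2) = <-≤-trans (conj-horner-∷-<-suc d ds (conj-horner<θ ds ds<a (noForbidden-∷ nf)))
                                        (≤-trans (fromℕ-mono-≤ d<a∸2) (<⇒≤ a-2<θ-1))

  greedy-band : ∀ {α m} → GreedyLowExp α m → pow (ℤ.- m) ≤ ∣ conj α ∣ × ∣ conj α ∣ < θ * pow (ℤ.- m)
  greedy-band {α} {m} (b , bs , b≢0 , (digits<a , nf) , α≡±eval) =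
    subst (P ≤_) (sym (∣conjα∣≡PS α≡±eval)) P≤PS , subst (_< θ * P) (sym (∣conjα∣≡PS α≡±eval)) PS<θP
    where
    P S : Zθ
    P = pow (ℤ.- m)
    S = conj (horner (b ∷ bs))
    0<P : 𝟘 < P
    0<P = 0<pow (ℤ.- m)
    ∣conj-eval∣≡PS : ∣ conj (eval m (b ∷ bs)) ∣ ≡ P * S
    ∣conj-eval∣≡PS = begin
      ∣ conj (pow m * horner (b ∷ bs)) ∣  ≡⟨ cong ∣_∣ (trans (conj-* (pow m) _) (cong (_* S) (conj-pow m))) ⟩
      ∣ P * S ∣                           ≡⟨ ∣c*x∣≡c*∣x∣ S 0<P ⟩
      P * ∣ S ∣                           ≡⟨ cong (P *_) (0≤x⇒∣x∣≡x (0≤conj-horner (b ∷ bs))) ⟩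
      P * S                               ∎
      where open ≡-Reasoning
    ∣conjα∣≡PS : ∀ {α} → α ≡ eval m (b ∷ bs) ⊎ α ≡ - eval m (b ∷ bs) → ∣ conj α ∣ ≡ P * S
    ∣conjα∣≡PS (inj₁ refl) = ∣conj-eval∣≡PS
    ∣conjα∣≡PS (inj₂ refl) = trans (∣conj-neg∣ (eval m (b ∷ bs))) ∣conj-eval∣≡PS
    P≤PS : P ≤ P * S
    P≤PS = subst (_≤ P * S) (*-identityʳ P) (*-monoʳ-≤ (<⇒≤ 0<P) (1≤conj-horner bs b≢0))
    PS<θP : P * S < θ * P
    PS<θP = subst (P * S <_) (*-comm P θ) (*-monoʳ-< 0<P (conj-horner<θ (b ∷ bs) digits<a nf))

  -- The sign classes 𝒪⁰ and 𝒪¹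

  data Class (x : Zθ) : Set where
    is-𝟘 : x ≡ 𝟘 → Class x
    O⁰   : InO0 x → x ≢ 𝟘 → Class x
    O¹   : InO1 x → x ≢ 𝟘 → Class x

  classify : ∀ x → Class x
  classify x = by-signs (compare 𝟘 x) (compare 𝟘 (conj x))
    where
    conj≡𝟘 : conj x ≡ 𝟘 → 𝟘 ≡ x
    conj≡𝟘 x′≡0 = trans (sym (conj-fromℕ 0)) (trans (cong conj (sym x′≡0)) (conj-conj x))
    by-signs : Tri (𝟘 < x) (𝟘 ≡ x) (x < 𝟘) → Tri (𝟘 < conj x) (𝟘 ≡ conj x) (conj x < 𝟘) → Class x
    by-signs (tri≈ _ 0≡x _) _ = is-𝟘 (sym 0≡x)
    by-signs (tri< 0<x 0≢x _) (tri< 0<x′ _ _) = O⁰ (inj₂ (inj₁ (0<⇒Pos 0<x , 0<⇒Pos 0<x′))) (0≢x ∘ sym)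
    by-signs (tri< 0<x 0≢x _) (tri> _ _ x′<0) = O¹ (inj₂ (inj₁ (0<⇒Pos 0<x , <0⇒Neg x′<0))) (0≢x ∘ sym)
    by-signs (tri> _ 0≢x x<0) (tri< 0<x′ _ _) = O¹ (inj₂ (inj₂ (<0⇒Neg x<0 , 0<⇒Pos 0<x′))) (0≢x ∘ sym)
    by-signs (tri> _ 0≢x x<0) (tri> _ _ x′<0) = O⁰ (inj₂ (inj₂ (<0⇒Neg x<0 , <0⇒Neg x′<0))) (0≢x ∘ sym)
    by-signs (tri< _ 0≢x _) (tri≈ _ 0≡x′ _) = ⊥-elim (0≢x (conj≡𝟘 (sym 0≡x′)))
    by-signs (tri> _ 0≢x _) (tri≈ _ 0≡x′ _) = ⊥-elim (0≢x (conj≡𝟘 (sym 0≡x′)))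

  private
    Pos⇒Neg-neg : ∀ {x} → Pos x → Neg (- x)
    Pos⇒Neg-neg {x} = subst Pos (sym (-‿involutive x))

  InO0-neg : ∀ {x} → InO0 x → InO0 (- x)
  InO0-neg (inj₁ refl) = inj₁ refl
  InO0-neg {x} (inj₂ (inj₁ (x>0 , x′>0))) =
    inj₂ (inj₂ (Pos⇒Neg-neg {x} x>0 , subst Neg (sym (conj-neg x)) (Pos⇒Neg-neg {conj x} x′>0)))
  InO0-neg {x} (inj₂ (inj₂ (x<0 , x′<0))) = inj₂ (inj₁ (x<0 , subst Pos (sym (conj-neg x)) x′<0))

  InO1-neg : ∀ {x} → InO1 x → InO1 (- x)
  InO1-neg (inj₁ refl) = inj₁ refl
  InO1-neg {x} (inj₂ (inj₁ (x>0 , x′<0))) = inj₂ (inj₂ (Pos⇒Neg-neg {x} x>0 , subst Pos (sym (conj-neg x)) x′<0))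
  InO1-neg {x} (inj₂ (inj₂ (x<0 , x′>0))) =
    inj₂ (inj₁ (x<0 , subst Neg (sym (conj-neg x)) (Pos⇒Neg-neg {conj x} x′>0)))

  θ*conj[Tθ]≡-Tθ : θ * conj Tθ ≡ - Tθ
  θ*conj[Tθ]≡-Tθ = cong₂ ⟨_,_⟩ (on-re A) (on-im A)
    where
    on-re : ∀ k → 0ℤ ℤ.* (ℤ.- 1ℤ ℤ.+ k ℤ.* 1ℤ) ℤ.- 1ℤ ℤ.* ℤ.- 1ℤ ≡ 1ℤ
    on-re = solve-∀
    on-im : ∀ k → 0ℤ ℤ.* ℤ.- 1ℤ ℤ.+ 1ℤ ℤ.* (ℤ.- 1ℤ ℤ.+ k ℤ.* 1ℤ) ℤ.+ k ℤ.* 1ℤ ℤ.* ℤ.- 1ℤ ≡ ℤ.- 1ℤ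
    on-im = solve-∀

  conj[Tθ]<0 : conj Tθ < 𝟘
  conj[Tθ]<0 = *-cancelˡ-< (<⇒≤ 0<θ) (subst₂ _<_ (sym θ*conj[Tθ]≡-Tθ) (sym (zeroʳ θ)) (0<x⇒-x<0 0<Tθ))

  Tθ*-O¹⇒O⁰ : ∀ {x} → InO1 x → x ≢ 𝟘 → InO0 (Tθ * x) × Tθ * x ≢ 𝟘
  Tθ*-O¹⇒O⁰ (inj₁ x≡0) x≢0 = ⊥-elim (x≢0 x≡0)
  Tθ*-O¹⇒O⁰ {x} (inj₂ (inj₁ (x>0 , x′<0))) _ =
    inj₂ (inj₁ (0<⇒Pos 0<Tx ,
                0<⇒Pos (subst (𝟘 <_) (sym (conj-* Tθ x)) (*-neg-neg conj[Tθ]<0 (Neg⇒<0 {conj x} x′<0))))) ,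
    λ Tx≡0 → <-irrefl (sym Tx≡0) 0<Tx
    where
    0<Tx : 𝟘 < Tθ * x
    0<Tx = 0<* 0<Tθ (Pos⇒0< {x} x>0)
  Tθ*-O¹⇒O⁰ {x} (inj₂ (inj₂ (x<0 , x′>0))) _ =
    inj₂ (inj₂ (<0⇒Neg Tx<0 , <0⇒Neg (subst (_< 𝟘) (trans (*-comm (conj x) (conj Tθ)) (sym (conj-* Tθ x)))
                                                      (*-pos-neg (Pos⇒0< {conj x} x′>0) conj[Tθ]<0)))) ,
    λ Tx≡0 → <-irrefl Tx≡0 Tx<0
    where
    Tx<0 : Tθ * x < 𝟘
    Tx<0 = *-pos-neg 0<Tθ (Neg⇒<0 {x} x<0)

  θ*∣conj[Tθ*x]∣ : ∀ x → θ * ∣ conj (Tθ * x) ∣ ≡ Tθ * ∣ conj x ∣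
  θ*∣conj[Tθ*x]∣ x = begin
    θ * ∣ conj (Tθ * x) ∣          ≡⟨ ∣c*x∣≡c*∣x∣ (conj (Tθ * x)) 0<θ ⟨
    ∣ θ * conj (Tθ * x) ∣          ≡⟨ cong (λ y → ∣ θ * y ∣) (conj-* Tθ x) ⟩
    ∣ θ * (conj Tθ * conj x) ∣     ≡⟨ cong ∣_∣ (sym (*-assoc θ (conj Tθ) (conj x))) ⟩
    ∣ θ * conj Tθ * conj x ∣       ≡⟨ cong (λ y → ∣ y * conj x ∣) θ*conj[Tθ]≡-Tθ ⟩
    ∣ - Tθ * conj x ∣              ≡⟨ cong ∣_∣ (sym (-‿distribˡ-* Tθ (conj x))) ⟩
    ∣ - (Tθ * conj x) ∣            ≡⟨ ∣-x∣≡∣x∣ (Tθ * conj x) ⟩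
    ∣ Tθ * conj x ∣                ≡⟨ ∣c*x∣≡c*∣x∣ (conj x) 0<Tθ ⟩
    Tθ * ∣ conj x ∣                ∎
    where open ≡-Reasoning

  module ThetaNorm (N : Zθ → Zθ) (isThetaNorm : IsThetaNorm N) where

    private
      N-zero : ∀ {x} → x ≡ 𝟘 → N x ≡ 𝟘
      N-zero {x} = proj₁ (isThetaNorm x)

      N-O¹ : ∀ {x} → InO1 x → x ≢ 𝟘 → N x ≡ N (Tθ * x)
      N-O¹ {x} = proj₂ (proj₂ (isThetaNorm x))

    N-band⁰ : ∀ {x} → InO0 x → x ≢ 𝟘 → ∃ λ k → N x ≡ pow k × pow k ≤ ∣ conj x ∣ × ∣ conj x ∣ < θ * pow k
    N-band⁰ {x} x∈O⁰ x≢0 = band (proj₁ (proj₂ (isThetaNorm x)) x∈O⁰ x≢0)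
      where
      band : Σ ℤ (λ m → GreedyLowExp x m × N x ≡ pow (ℤ.- m)) →
             ∃ λ k → N x ≡ pow k × pow k ≤ ∣ conj x ∣ × ∣ conj x ∣ < θ * pow k
      band (m , greedy , Nx≡θ⁻ᵐ) = ℤ.- m , Nx≡θ⁻ᵐ , greedy-band {x} {m} greedy

    N-band¹ : ∀ {x} → InO1 x → x ≢ 𝟘 →
              ∃ λ k → N x ≡ pow k × θ * pow k ≤ Tθ * ∣ conj x ∣ × Tθ * ∣ conj x ∣ < θ * (θ * pow k)
    N-band¹ {x} x∈O¹ x≢0 = band (N-band⁰ (proj₁ (Tθ*-O¹⇒O⁰ x∈O¹ x≢0)) (proj₂ (Tθ*-O¹⇒O⁰ x∈O¹ x≢0)))
      where
      band : ∃ (λ k → N (Tθ * x) ≡ pow k × pow k ≤ ∣ conj (Tθ * x) ∣ × ∣ conj (Tθ * x) ∣ < θ * pow k) →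
             ∃ λ k → N x ≡ pow k × θ * pow k ≤ Tθ * ∣ conj x ∣ × Tθ * ∣ conj x ∣ < θ * (θ * pow k)
      band (k , NTx≡θᵏ , θᵏ≤∣Tx′∣ , ∣Tx′∣<θᵏ⁺¹) =
        k , trans (N-O¹ x∈O¹ x≢0) NTx≡θᵏ ,
        subst (θ * pow k ≤_) (θ*∣conj[Tθ*x]∣ x) (*-monoʳ-≤ (<⇒≤ 0<θ) θᵏ≤∣Tx′∣) ,
        subst (_< θ * (θ * pow k)) (θ*∣conj[Tθ*x]∣ x) (*-monoʳ-< 0<θ ∣Tx′∣<θᵏ⁺¹)

    private
      ∣conj𝟘∣≡𝟘 : ∣ conj 𝟘 ∣ ≡ 𝟘
      ∣conj𝟘∣≡𝟘 = trans (cong ∣_∣ (conj-fromℕ 0)) (0≤x⇒∣x∣≡x ≤-refl)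

      Tθ≤θ : Tθ ≤ θ
      Tθ≤θ = <⇒≤ (x-y<x 0<1)

    N-power : ∀ x → PowerOfθOrZero (N x)
    N-power x = by-class (classify x)
      where
      by-class : Class x → PowerOfθOrZero (N x)
      by-class (is-𝟘 x≡0) = inj₁ (N-zero x≡0)
      by-class (O⁰ x∈O⁰ x≢0) = let k , Nx≡θᵏ , _ = N-band⁰ x∈O⁰ x≢0 in inj₂ (k , Nx≡θᵏ)
      by-class (O¹ x∈O¹ x≢0) = let k , Nx≡θᵏ , _ = N-band¹ x∈O¹ x≢0 in inj₂ (k , Nx≡θᵏ)

    0≤N : ∀ x → 𝟘 ≤ N x
    0≤N x = PowerOfθOrZero⇒0≤ (N-power x)

    N≡𝟘⇒≡𝟘 : ∀ x → N x ≡ 𝟘 → x ≡ 𝟘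
    N≡𝟘⇒≡𝟘 x Nx≡0 = by-class (classify x)
      where
      by-class : Class x → x ≡ 𝟘
      by-class (is-𝟘 x≡0) = x≡0
      by-class (O⁰ x∈O⁰ x≢0) = let k , Nx≡θᵏ , _ = N-band⁰ x∈O⁰ x≢0 in
        ⊥-elim (<-irrefl (trans (sym Nx≡0) Nx≡θᵏ) (0<pow k))
      by-class (O¹ x∈O¹ x≢0) = let k , Nx≡θᵏ , _ = N-band¹ x∈O¹ x≢0 in
        ⊥-elim (<-irrefl (trans (sym Nx≡0) Nx≡θᵏ) (0<pow k))

    N≤∣conj∣ : ∀ x → N x ≤ ∣ conj x ∣
    N≤∣conj∣ x = by-class (classify x)
      where
      by-class : Class x → N x ≤ ∣ conj x ∣
      by-class (is-𝟘 x≡0) =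
        subst (λ x → N x ≤ ∣ conj x ∣) (sym x≡0) (inj₂ (trans (N-zero refl) (sym ∣conj𝟘∣≡𝟘)))
      by-class (O⁰ x∈O⁰ x≢0) = let k , Nx≡θᵏ , θᵏ≤∣x′∣ , _ = N-band⁰ x∈O⁰ x≢0 in
        subst (_≤ ∣ conj x ∣) (sym Nx≡θᵏ) θᵏ≤∣x′∣
      by-class (O¹ x∈O¹ x≢0) = let k , Nx≡θᵏ , θᵏ⁺¹≤T∣x′∣ , _ = N-band¹ x∈O¹ x≢0 in
        subst (_≤ ∣ conj x ∣) (sym Nx≡θᵏ) (cancel-θ θᵏ⁺¹≤T∣x′∣)
        where
        cancel-θ : ∀ {y} → θ * y ≤ Tθ * ∣ conj x ∣ → y ≤ ∣ conj x ∣
        cancel-θ {y} θy≤T∣x′∣ = *-cancelˡ-≤ {θ} {y} {∣ conj x ∣} 0<θ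
          (≤-trans {θ * y} {Tθ * ∣ conj x ∣} {θ * ∣ conj x ∣} θy≤T∣x′∣
                   (*-monoˡ-≤ {∣ conj x ∣} {Tθ} {θ} (0≤∣x∣ (conj x)) Tθ≤θ))

    ∣conj∣≤θN : ∀ {x} → InO0 x → ∣ conj x ∣ ≤ θ * N x
    ∣conj∣≤θN (inj₁ refl) = inj₂ (trans ∣conj𝟘∣≡𝟘 (sym (trans (cong (θ *_) (N-zero refl)) (zeroʳ θ))))
    ∣conj∣≤θN {x} x∈O⁰@(inj₂ signs) =
      let k , Nx≡θᵏ , _ , ∣x′∣<θᵏ⁺¹ = N-band⁰ x∈O⁰ (x≢0 signs) in
      subst (λ n → ∣ conj x ∣ ≤ θ * n) (sym Nx≡θᵏ) (<⇒≤ ∣x′∣<θᵏ⁺¹)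
      where
      x≢0 : (Pos x × Pos (conj x)) ⊎ (Neg x × Neg (conj x)) → x ≢ 𝟘
      x≢0 (inj₁ (x>0 , _)) x≡0 = <-irrefl (sym x≡0) (Pos⇒0< {x} x>0)
      x≢0 (inj₂ (x<0 , _)) x≡0 = <-irrefl x≡0 (Neg⇒<0 {x} x<0)

    Tθ∣conj∣≤θ²N : ∀ x → Tθ * ∣ conj x ∣ ≤ θ * (θ * N x)
    Tθ∣conj∣≤θ²N x = by-class (classify x)
      where
      by-class : Class x → Tθ * ∣ conj x ∣ ≤ θ * (θ * N x)
      by-class (is-𝟘 x≡0) = subst (λ x → Tθ * ∣ conj x ∣ ≤ θ * (θ * N x)) (sym x≡0) (inj₂ (begin
        Tθ * ∣ conj 𝟘 ∣   ≡⟨ trans (cong (Tθ *_) ∣conj𝟘∣≡𝟘) (zeroʳ Tθ) ⟩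
        𝟘                 ≡⟨ trans (cong (θ *_) (zeroʳ θ)) (zeroʳ θ) ⟨
        θ * (θ * 𝟘)       ≡⟨ cong (λ n → θ * (θ * n)) (N-zero refl) ⟨
        θ * (θ * N 𝟘)     ∎))
        where open ≡-Reasoning
      by-class (O⁰ x∈O⁰ x≢0) = let k , Nx≡θᵏ , _ , ∣x′∣<θᵏ⁺¹ = N-band⁰ x∈O⁰ x≢0 in
        subst (λ n → Tθ * ∣ conj x ∣ ≤ θ * (θ * n)) (sym Nx≡θᵏ)
          (≤-trans (*-monoˡ-≤ (0≤∣x∣ (conj x)) Tθ≤θ) (*-monoʳ-≤ (<⇒≤ 0<θ) (<⇒≤ ∣x′∣<θᵏ⁺¹)))
      by-class (O¹ x∈O¹ x≢0) = let k , Nx≡θᵏ , _ , T∣x′∣<θᵏ⁺² = N-band¹ x∈O¹ x≢0 in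
        subst (λ n → Tθ * ∣ conj x ∣ ≤ θ * (θ * n)) (sym Nx≡θᵏ) (<⇒≤ T∣x′∣<θᵏ⁺²)

    N-neg : ∀ x → N (- x) ≡ N x
    N-neg x = by-class (classify x)
      where
      N-neg⁰ : ∀ {y} → InO0 y → y ≢ 𝟘 → N (- y) ≡ N y
      N-neg⁰ {y} y∈O⁰ y≢0 =
        let k , Ny≡θᵏ , θᵏ≤∣y′∣ , ∣y′∣<θᵏ⁺¹ = N-band⁰ y∈O⁰ y≢0
            j , N[-y]≡θʲ , θʲ≤∣-y′∣ , ∣-y′∣<θʲ⁺¹ = N-band⁰ (InO0-neg y∈O⁰) (y≢0 ∘ -‿injective)
        in trans N[-y]≡θʲ (trans (pow-band-unique {j} {k} (subst (pow j ≤_) (∣conj-neg∣ y) θʲ≤∣-y′∣)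
                                                   (subst (_< θ * pow j) (∣conj-neg∣ y) ∣-y′∣<θʲ⁺¹)
                                                   θᵏ≤∣y′∣ ∣y′∣<θᵏ⁺¹)
                                 (sym Ny≡θᵏ))
      by-class : Class x → N (- x) ≡ N x
      by-class (is-𝟘 refl) = refl
      by-class (O⁰ x∈O⁰ x≢0) = N-neg⁰ x∈O⁰ x≢0
      by-class (O¹ x∈O¹ x≢0) = let Tx∈O⁰ , Tx≢0 = Tθ*-O¹⇒O⁰ x∈O¹ x≢0 in begin
        N (- x)           ≡⟨ N-O¹ (InO1-neg x∈O¹) (x≢0 ∘ -‿injective) ⟩
        N (Tθ * - x)      ≡⟨ cong N (sym (-‿distribʳ-* Tθ x)) ⟩
        N (- (Tθ * x))    ≡⟨ N-neg⁰ Tx∈O⁰ Tx≢0 ⟩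
        N (Tθ * x)        ≡⟨ N-O¹ x∈O¹ x≢0 ⟨
        N x               ∎
        where open ≡-Reasoning

    private
      max-power : ∀ f g → PowerOfθOrZero (max (N f) (N g))
      max-power f g with max-sel (N f) (N g)
      ... | inj₁ M≡Nf = subst PowerOfθOrZero (sym M≡Nf) (N-power f)
      ... | inj₂ M≡Ng = subst PowerOfθOrZero (sym M≡Ng) (N-power g)

    N-+-O⁰ : ∀ {f g} → InO0 f → InO0 g → N (f + g) ≤ θ * max (N f) (N g)
    N-+-O⁰ {f} {g} f∈O⁰ g∈O⁰ =
      power-gap (N-power (f + g)) (θ*-PowerOfθOrZero (max-power f g)) 0<1 bound
                (subst (𝟙 + 𝟙 <_) (sym (*-identityˡ θ)) 2<θ)
      where
      open ≤-Reasoning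
      M : Zθ
      M = max (N f) (N g)
      θ*-mono : ∀ {x y} → x ≤ y → θ * x ≤ θ * y
      θ*-mono = *-monoʳ-≤ (<⇒≤ 0<θ)
      bound : 𝟙 * N (f + g) ≤ θ * M + θ * M
      bound = begin
        𝟙 * N (f + g)              ≡⟨ *-identityˡ (N (f + g)) ⟩
        N (f + g)                  ≤⟨ N≤∣conj∣ (f + g) ⟩
        ∣ conj (f + g) ∣           ≡⟨ cong ∣_∣ (conj-+ f g) ⟩
        ∣ conj f + conj g ∣        ≤⟨ ∣x+y∣≤∣x∣+∣y∣ (conj f) (conj g) ⟩
        ∣ conj f ∣ + ∣ conj g ∣    ≤⟨ +-mono-≤ (∣conj∣≤θN f∈O⁰) (∣conj∣≤θN g∈O⁰) ⟩
        θ * N f + θ * N g          ≤⟨ +-mono-≤ (θ*-mono (x≤max (N f) (N g))) (θ*-mono (y≤max (N f) (N g))) ⟩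
        θ * M + θ * M              ∎

    N-+ : ∀ f g → N (f + g) ≤ θ * (θ * max (N f) (N g))
    N-+ f g =
      power-gap (N-power (f + g)) (θ*-PowerOfθOrZero (θ*-PowerOfθOrZero (max-power f g))) 0<Tθ bound 2<[θ-1]θ
      where
      open ≤-Reasoning
      M : Zθ
      M = max (N f) (N g)
      θ²-mono : ∀ {x y} → x ≤ y → θ * (θ * x) ≤ θ * (θ * y)
      θ²-mono x≤y = *-monoʳ-≤ (<⇒≤ 0<θ) (*-monoʳ-≤ (<⇒≤ 0<θ) x≤y)
      bound : Tθ * N (f + g) ≤ θ * (θ * M) + θ * (θ * M)
      bound = begin
        Tθ * N (f + g)                      ≤⟨ *-monoʳ-≤ (<⇒≤ 0<Tθ) (N≤∣conj∣ (f + g)) ⟩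
        Tθ * ∣ conj (f + g) ∣               ≡⟨ cong (λ y → Tθ * ∣ y ∣) (conj-+ f g) ⟩
        Tθ * ∣ conj f + conj g ∣            ≤⟨ *-monoʳ-≤ (<⇒≤ 0<Tθ) (∣x+y∣≤∣x∣+∣y∣ (conj f) (conj g)) ⟩
        Tθ * (∣ conj f ∣ + ∣ conj g ∣)      ≡⟨ distribˡ Tθ ∣ conj f ∣ ∣ conj g ∣ ⟩
        Tθ * ∣ conj f ∣ + Tθ * ∣ conj g ∣   ≤⟨ +-mono-≤ (Tθ∣conj∣≤θ²N f) (Tθ∣conj∣≤θ²N g) ⟩
        θ * (θ * N f) + θ * (θ * N g)       ≤⟨ +-mono-≤ (θ²-mono (x≤max (N f) (N g))) (θ²-mono (y≤max (N f) (N g))) ⟩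
        θ * (θ * M) + θ * (θ * M)           ∎

    N-+-θ² : ∀ f g → N (f + g) ≤ powℕ θ 2 * max (N f) (N g)
    N-+-θ² f g = subst (N (f + g) ≤_) (sym (θ²*x≡θ*[θ*x] (max (N f) (N g)))) (N-+ f g)

    N-+-θ⁴ : ∀ f g → N (f + g) ≤ powℕ θ 4 * max (N f) (N g)
    N-+-θ⁴ f g = ≤-trans (N-+-θ² f g)
      (*-monoˡ-≤ (≤-trans (0≤N f) (x≤max (N f) (N g))) (powℕ-monoʳ-≤ (<⇒≤ 1<θ) {2} {4} (s≤s (s≤s z≤n))))

    N-−-θ⁴ : ∀ f g → N (f - g) ≤ powℕ θ 4 * max (N f) (N g)
    N-−-θ⁴ f g = subst (λ n → N (f - g) ≤ powℕ θ 4 * max (N f) n) (N-neg g) (N-+-θ⁴ f (- g))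

theorem8 : (a : ℕ) → 3 ℕ.≤ a → let open Q a in
    (N : Zθ → Zθ) → IsThetaNorm N →
    (∀ f g → InO0 f → InO0 g → N (f + g) ≤ θ * max (N f) (N g))
    × (∀ f g → InO1 f → InO1 g → N (f + g) ≤ powℕ θ 2 * max (N f) (N g))
    × (∀ f g → InO0 f → InO1 g → N (f + g) ≤ powℕ θ 4 * max (N f) (N g))
    × IsInfranorm N (powℕ θ 4)
theorem8 a 3≤a N isThetaNorm =
    (λ f g f∈O⁰ g∈O⁰ → ≤⇒≤ᵇ (N-+-O⁰ f∈O⁰ g∈O⁰))
    -- the bounds θ² and θ⁴ hold whatever the sign classes of f and g
  , (λ f g _ _ → ≤⇒≤ᵇ (N-+-θ² f g))
  , (λ f g _ _ → ≤⇒≤ᵇ (N-+-θ⁴ f g))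
  , ≤⇒≤ᵇ 1≤θ⁴
  , (λ x → ≤⇒≤ᵇ (0≤N x))
  , (λ x → N≡𝟘⇒≡𝟘 x , proj₁ (isThetaNorm x))
  , N-neg
  , (λ f g → ≤⇒≤ᵇ (N-+-θ⁴ f g) , ≤⇒≤ᵇ (N-−-θ⁴ f g))
  where
  open ThetaExpansions a 3≤a
  open ThetaNorm N isThetaNorm
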